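{- Let $D=(V,E)$ be a simple $r$-regular digraph with $n$ vertices and $m$ arcs. Then, as identities of rational functions in $\lambda$: (a1) $A(\lambda, D^{ -00}) = (-1)^n \lambda^{m} (\lambda - n + r + 1)(\lambda + r + 1)^{ -1} A(-\lambda -1, D)$; (a2) $A(\lambda, D^{ -10}) = (-1)^n (\lambda +1)^{m-1} (\lambda- m + 1) (\lambda - n + r + 1)(\lambda + r + 1)^{ -1} A(-\lambda -1, D)$; (a3) $A(\lambda, D^{0-0}) = (-1)^n \lambda^{n} (\lambda + 1)^{m-n} (\lambda - m + r + 1)(\lambda + r + 1)^{ -1} A(-\lambda - 1, D)$; (a4) $A(\lambda, D^{1-0}) = (-1)^n (\lambda + 1)^{m - 1} (\lambda -n + 1) (\lambda - m + r + 1)(\lambda + r + 1)^{ -1} A(-\lambda -1, D)$; (a5) $A(\lambda ,D^{ -+0}) = (-1)^n \lambda^{m - n} (\lambda - n + r + 1)(\lambda + r + 1)^{ -1} A(- \lambda - 1, D) A(\lambda , D)$; (a6) $A(\lambda , D^{+-0}) = (-1)^n (\lambda + 1)^{m - n} (\lambda - m + r + 1)(\lambda + r + 1)^{ -1} A(- \lambda - 1, D) A( \lambda , D)$; (a7) $A(\lambda ,D^{ --0}) = ( \lambda + 1)^{m - n} (\lambda - n + r + 1)(\lambda - m + r + 1) (\lambda + r + 1)^{ -2} A( - \lambda - 1 , D)^2$.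
   Context: A simple digraph is $D=(V,E)$ with $V$ finite nonempty and $E\subseteq\{(u,v)\in V\times V: u\neq v\}$; for an arc $e=(u,v)$, $t(e)=u$, $h(e)=v$. $D$ is $r$-regular if every vertex has in-degree and out-degree equal to $r$. $A(D)$ is the 0/1 adjacency matrix and $A(\lambda,D)=\det(\lambda I-A(D))$. The line digraph $D^l$ has vertex set $E$ and arcs $(p,q)$ for $p,q\in E$ with $h(p)=t(q)$. For a simple digraph $G$ on vertex set $U$: $G^0$ has no arcs, $G^1$ has all arcs $(u,v)$ with $u\ne v$, $G^+=G$, and $G^-$ is the complement of $G$ (all $(u,v)$, $u\neq v$, not arcs of $G$). For $x,y\in\{0,1,+,-\}$, $D^{xy0}$ is the digraph with vertex set $V\cup E$ (disjoint union) whose arc set is the union of the arcs of $D^x$ (on $V$) and of $(D^l)^y$ (on $E$). -}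

module Defs where

open import Data.Nat using (ℕ; zero; suc) renaming (_+_ to _+ℕ_)
open import Data.Integer using (ℤ; +_; -_; _+_; _-_; _*_; _^_; 0ℤ; 1ℤ; -1ℤ)
open import Data.Fin using (Fin; zero; suc; toℕ; punchIn; splitAt)
open import Data.Bool using (Bool; true; false; not; _∧_; if_then_else_)
open import Data.List using (List; []; _∷_; concatMap; allFin; length; lookup)
open import Data.Product using (_×_; _,_; proj₁; proj₂)
open import Data.Sum using (inj₁; inj₂)
open import Relation.Nullary.Decidable using (⌊_⌋)
open import Relation.Binary.PropositionalEquality using (_≡_)
import Data.Fin as F

_==_ : ∀ {k} → Fin k → Fin k → Bool
i == j = ⌊ i F.≟ j ⌋

Rel : ℕ → Set
Rel n = Fin n → Fin n → Bool

-- simple: no loops (multiple arcs are excluded by using a relation)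
Loopless : ∀ {n} → Rel n → Set
Loopless {n} adj = ∀ (v : Fin n) → adj v v ≡ false

count : ∀ {k} → (Fin k → Bool) → ℕ
count {zero} p = zero
count {suc k} p = (if p zero then 1 else 0) +ℕ count {k} (λ i → p (suc i))

outdeg indeg : ∀ {n} → Rel n → Fin n → ℕ
outdeg adj v = count (λ u → adj v u)
indeg adj v = count (λ u → adj u v)

Regular : ∀ {n} → Rel n → ℕ → Set
Regular {n} adj r = ∀ (v : Fin n) → (outdeg adj v ≡ r) × (indeg adj v ≡ r)

arcs : ∀ {n} → Rel n → List (Fin n × Fin n)
arcs {n} adj = concatMap (λ u → concatMap (λ v → if adj u v then (u , v) ∷ [] else []) (allFin n)) (allFin n)

numArcs : ∀ {n} → Rel n → ℕ
numArcs adj = length (arcs adj)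

arc : ∀ {n} (adj : Rel n) → Fin (numArcs adj) → Fin n × Fin n
arc adj = lookup (arcs adj)

tail head : ∀ {n} (adj : Rel n) → Fin (numArcs adj) → Fin n
tail adj e = proj₁ (arc adj e)
head adj e = proj₂ (arc adj e)

lineDigraph : ∀ {n} (adj : Rel n) → Rel (numArcs adj)
lineDigraph adj p q = head adj p == tail adj q

data Op : Set where
  o0 o1 o+ o- : Op

apply : Op → ∀ {k} → Rel k → Rel k
apply o0 G i j = false
apply o1 G i j = not (i == j)
apply o+ G i j = G i j
apply o- G i j = not (i == j) ∧ not (G i j)

-- D^{xy0}: vertex set V ⊎ E represented as Fin (n + m)
xy0 : Op → Op → ∀ {n} (adj : Rel n) → Rel (n +ℕ numArcs adj)
xy0 x y {n} adj a b with splitAt n a | splitAt n b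
... | inj₁ i | inj₁ j = apply x adj i j
... | inj₂ p | inj₂ q = apply y (lineDigraph adj) p q
... | _ | _ = false

Matrix : ℕ → Set
Matrix k = Fin k → Fin k → ℤ

∑ : ∀ {k} → (Fin k → ℤ) → ℤ
∑ {zero} f = 0ℤ
∑ {suc k} f = f zero + ∑ (λ i → f (suc i))

det : ∀ {k} → Matrix k → ℤ
det {zero} M = 1ℤ
det {suc k} M = ∑ (λ j → (-1ℤ ^ toℕ j) * (M zero j * det (λ a b → M (suc a) (punchIn j b))))

adjMatrix : ∀ {k} → Rel k → Matrix k
adjMatrix G i j = if G i j then 1ℤ else 0ℤ

-- A(λ, G) = det(λ I - A(G)), evaluated at λ ∈ ℤ
charPoly : ∀ {k} → Rel k → ℤ → ℤ
charPoly G λ' = det (λ i j → (if i == j then λ' else 0ℤ) - adjMatrix G i j)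

-- The characteristic polynomial of D^{xy0} factors as A(λ, D^x) · A(λ, (Dˡ)^y), because no arc
-- joins V and E.  For a loopless digraph G on k vertices with all in-degrees r, the matrix
-- X = (λ + 1) I + A(G) has all column sums λ + 1 + r, λ I - A(G⁻) is X minus the all-ones matrix
-- and (- λ - 1) I - A(G) is - X; this gives the complement formula
--   (λ + r + 1) A(λ, G⁻) = (-1)^k (λ - k + r + 1) A(- λ - 1, G),
-- which applies to D and to its line digraph Dˡ, again loopless with all in-degrees r.  Writing
-- A(D) = C B and A(Dˡ) = B C with the tail and head incidence matrices, Sylvester's identity
-- λ^m A(λ, D) = λ^n A(λ, Dˡ) links the two.  The seven identities are products of these facts.

{-# OPTIONS --safe #-}
module Submission where

open import Defs
open import Data.Nat using (ℕ; NonZero; zero; suc) renaming (_+_ to _+ℕ_)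
open import Data.Integer using (ℤ; +_; -_; _+_; _-_; _*_; _^_; 0ℤ; 1ℤ; -1ℤ; +[1+_]; -[1+_])
import Data.Integer.Properties as ℤ
open import Data.Integer.Tactic.RingSolver using (solve-∀)
open import Data.Fin using (Fin; zero; suc; toℕ; punchIn; lift; _↑ˡ_; _↑ʳ_; splitAt)
open import Data.Fin.Properties using (_≟_; suc-injective; toℕ-↑ˡ; ↑ˡ-injective; ↑ʳ-injective; splitAt-↑ˡ; splitAt-↑ʳ)
open import Data.Vec.Functional using (_∷_; _++_)
open import Data.Vec.Functional.Properties using (lookup-++ˡ; lookup-++ʳ)
open import Data.Bool using (Bool; true; false; if_then_else_)
open import Data.Product using (_×_; _,_; proj₁; proj₂)
open import Data.List using (List)
import Data.List as List
open import Data.List.Relation.Unary.All using (All)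
import Data.List.Relation.Unary.All as All
open import Data.List.Relation.Unary.All.Properties using (concat⁺; map⁺; tabulate⁺)
open import Data.List.Membership.Propositional.Properties using (∈-lookup)
open import Function using (_∘_)
open import Relation.Nullary using (yes; no; contradiction)
open import Relation.Nullary.Decidable using (isYes≗does; dec-true; dec-false)
open import Relation.Binary.PropositionalEquality

open ≡-Reasoning

-- Finite sums

∑-cong : ∀ {k} {f g : Fin k → ℤ} → f ≗ g → ∑ f ≡ ∑ g
∑-cong {zero}  _   = refl
∑-cong {suc k} f≗g = cong₂ _+_ (f≗g zero) (∑-cong (f≗g ∘ suc))

∑-zero : ∀ {k} {f : Fin k → ℤ} → (∀ i → f i ≡ 0ℤ) → ∑ f ≡ 0ℤ
∑-zero {zero}  _  = refl
∑-zero {suc k} f≡0 = cong₂ _+_ (f≡0 zero) (∑-zero (f≡0 ∘ suc))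

∑-distrib-+ : ∀ {k} (f g : Fin k → ℤ) → ∑ (λ i → f i + g i) ≡ ∑ f + ∑ g
∑-distrib-+ {zero}  f g = refl
∑-distrib-+ {suc k} f g = begin
  f zero + g zero + ∑ (λ i → f (suc i) + g (suc i))
    ≡⟨ cong (λ t → f zero + g zero + t) (∑-distrib-+ (f ∘ suc) (g ∘ suc)) ⟩
  f zero + g zero + (∑ (f ∘ suc) + ∑ (g ∘ suc))
    ≡⟨ interchange (f zero) (g zero) (∑ (f ∘ suc)) (∑ (g ∘ suc)) ⟩
  f zero + ∑ (f ∘ suc) + (g zero + ∑ (g ∘ suc)) ∎
  where
  interchange : ∀ a b c d → a + b + (c + d) ≡ a + c + (b + d)
  interchange = solve-∀

*-distribˡ-∑ : ∀ {k} c (f : Fin k → ℤ) → c * ∑ f ≡ ∑ (λ i → c * f i)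
*-distribˡ-∑ {zero}  c f = ℤ.*-zeroʳ c
*-distribˡ-∑ {suc k} c f =
  trans (ℤ.*-distribˡ-+ c (f zero) (∑ (f ∘ suc))) (cong (λ t → c * f zero + t) (*-distribˡ-∑ c (f ∘ suc)))

*-distribʳ-∑ : ∀ {k} c (f : Fin k → ℤ) → ∑ f * c ≡ ∑ (λ i → f i * c)
*-distribʳ-∑ c f = trans (ℤ.*-comm (∑ f) c) (trans (*-distribˡ-∑ c f) (∑-cong (λ i → ℤ.*-comm c (f i))))

∑-neg : ∀ {k} (f : Fin k → ℤ) → ∑ (λ i → - f i) ≡ - ∑ f
∑-neg f = begin
  ∑ (λ i → - f i)       ≡⟨ ∑-cong (λ i → sym (ℤ.-1*i≡-i (f i))) ⟩
  ∑ (λ i → -1ℤ * f i)   ≡⟨ *-distribˡ-∑ -1ℤ f ⟨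
  -1ℤ * ∑ f             ≡⟨ ℤ.-1*i≡-i (∑ f) ⟩
  - ∑ f                 ∎

∑-comm : ∀ {k l} (f : Fin k → Fin l → ℤ) → ∑ (λ i → ∑ (f i)) ≡ ∑ (λ j → ∑ (λ i → f i j))
∑-comm {zero} {l} f = sym (∑-zero {l} (λ _ → refl))
∑-comm {suc k} f = begin
  ∑ (f zero) + ∑ (λ i → ∑ (f (suc i)))          ≡⟨ cong (λ t → ∑ (f zero) + t) (∑-comm (f ∘ suc)) ⟩
  ∑ (f zero) + ∑ (λ j → ∑ (λ i → f (suc i) j))  ≡⟨ ∑-distrib-+ (f zero) _ ⟨
  ∑ (λ j → f zero j + ∑ (λ i → f (suc i) j))    ∎

∑-const : ∀ k a → ∑ {k} (λ _ → a) ≡ + k * a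
∑-const zero    a = refl
∑-const (suc k) a = begin
  a + ∑ {k} (λ _ → a)   ≡⟨ cong (λ t → a + t) (∑-const k a) ⟩
  a + + k * a           ≡⟨ distrib a (+ k) ⟩
  (1ℤ + + k) * a        ≡⟨ cong (_* a) (ℤ.pos-+ 1 k) ⟨
  + suc k * a           ∎
  where
  distrib : ∀ a k → a + k * a ≡ (1ℤ + k) * a
  distrib = solve-∀

∑-indicator : ∀ {k} (p : Fin k → Bool) → ∑ (λ i → if p i then 1ℤ else 0ℤ) ≡ + count p
∑-indicator {zero}  p = refl
∑-indicator {suc k} p = trans (cong₂ _+_ (indicator (p zero)) (∑-indicator (p ∘ suc)))
                              (sym (ℤ.pos-+ (if p zero then 1 else 0) (count (p ∘ suc))))
  where
  indicator : ∀ b → (if b then 1ℤ else 0ℤ) ≡ + (if b then 1 else 0)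
  indicator true  = refl
  indicator false = refl

-- Determinants

==-refl : ∀ {k} (i : Fin k) → (i == i) ≡ true
==-refl i = trans (isYes≗does (i ≟ i)) (dec-true (i ≟ i) refl)

==-≢ : ∀ {k} {i j : Fin k} → i ≢ j → (i == j) ≡ false
==-≢ {i = i} {j} i≢j = trans (isYes≗does (i ≟ j)) (dec-false (i ≟ j) i≢j)

==-injective : ∀ {k l} (f : Fin k → Fin l) → (∀ {i j} → f i ≡ f j → i ≡ j) →
               ∀ i j → (f i == f j) ≡ (i == j)
==-injective f f-inj i j with i ≟ j
... | yes refl = ==-refl (f i)
... | no i≢j   = ==-≢ (i≢j ∘ f-inj)

==-sym : ∀ {k} (i j : Fin k) → (i == j) ≡ (j == i)
==-sym i j with i ≟ j
... | yes refl = sym (==-refl i)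
... | no i≢j   = sym (==-≢ (i≢j ∘ sym))

Row : ℕ → Set
Row k = Fin k → ℤ

sign : ∀ {k} → Fin k → ℤ
sign j = -1ℤ ^ toℕ j

cofactor : ∀ {k} → (Fin k → Row (suc k)) → Fin (suc k) → ℤ
cofactor R j = sign j * det (λ a b → R a (punchIn j b))

det-cong : ∀ {k} {M N : Matrix k} → (∀ i j → M i j ≡ N i j) → det M ≡ det N
det-cong {zero}  _   = refl
det-cong {suc k} M≡N = ∑-cong λ j →
  cong₂ (λ x d → sign j * (x * d)) (M≡N zero j) (det-cong λ a b → M≡N (suc a) (punchIn j b))

det-∷ : ∀ {k} (x : Row (suc k)) R → det (x ∷ R) ≡ ∑ (λ j → x j * cofactor R j)
det-∷ x R = ∑-cong λ j → swap (sign j) (x j) (det (λ a b → R a (punchIn j b)))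
  where
  swap : ∀ s x d → s * (x * d) ≡ x * (s * d)
  swap = solve-∀

det-∷-cong : ∀ {k} (x : Row (suc k)) {R R′} → (∀ j → cofactor R j ≡ cofactor R′ j) →
             det (x ∷ R) ≡ det (x ∷ R′)
det-∷-cong x {R} {R′} eq = begin
  det (x ∷ R)                      ≡⟨ det-∷ x R ⟩
  ∑ (λ j → x j * cofactor R j)     ≡⟨ ∑-cong (λ j → cong (x j *_) (eq j)) ⟩
  ∑ (λ j → x j * cofactor R′ j)    ≡⟨ det-∷ x R′ ⟨
  det (x ∷ R′)                     ∎

det-∷-congˡ : ∀ {k} {x y : Row (suc k)} → x ≗ y → ∀ R → det (x ∷ R) ≡ det (y ∷ R)
det-∷-congˡ {x = x} {y} x≗y R = det-cong {M = x ∷ R} {y ∷ R} λ { zero j → x≗y j ; (suc a) j → refl }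

det-∷-scale : ∀ {k} c (x : Row (suc k)) R → det ((λ j → c * x j) ∷ R) ≡ c * det (x ∷ R)
det-∷-scale c x R = begin
  det ((λ j → c * x j) ∷ R)             ≡⟨ det-∷ (λ j → c * x j) R ⟩
  ∑ (λ j → c * x j * cofactor R j)      ≡⟨ ∑-cong (λ j → ℤ.*-assoc c (x j) (cofactor R j)) ⟩
  ∑ (λ j → c * (x j * cofactor R j))    ≡⟨ *-distribˡ-∑ c (λ j → x j * cofactor R j) ⟨
  c * ∑ (λ j → x j * cofactor R j)      ≡⟨ cong (c *_) (det-∷ x R) ⟨
  c * det (x ∷ R)                       ∎

det-∷-linear : ∀ {k} (x y : Row (suc k)) c R →
               det ((λ j → x j + c * y j) ∷ R) ≡ det (x ∷ R) + c * det (y ∷ R)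
det-∷-linear {k} x y c R = begin
  det ((λ j → x j + c * y j) ∷ R)            ≡⟨ det-∷ (λ j → x j + c * y j) R ⟩
  ∑ (λ j → (x j + c * y j) * cofactor R j)   ≡⟨ ∑-cong (λ j → distrib (x j) c (y j) (cofactor R j)) ⟩
  ∑ (λ j → xC j + c * yC j)                  ≡⟨ ∑-distrib-+ xC (λ j → c * yC j) ⟩
  ∑ xC + ∑ (λ j → c * yC j)                  ≡⟨ cong₂ _+_ (det-∷ x R) (trans (cong (c *_) (det-∷ y R)) (*-distribˡ-∑ c yC)) ⟨
  det (x ∷ R) + c * det (y ∷ R)              ∎
  where
  xC yC : Row (suc k)
  xC j = x j * cofactor R j
  yC j = y j * cofactor R j
  distrib : ∀ x c y d → (x + c * y) * d ≡ x * d + c * (y * d)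
  distrib = solve-∀

det-∷-∑ : ∀ {k l} (x : Row (suc k)) (w : Fin l → ℤ) (Y : Fin l → Row (suc k)) R →
          det ((λ j → x j + ∑ (λ b → w b * Y b j)) ∷ R) ≡ det (x ∷ R) + ∑ (λ b → w b * det (Y b ∷ R))
det-∷-∑ {k} x w Y R = begin
  det (z ∷ R)                                         ≡⟨ det-∷ z R ⟩
  ∑ (λ j → z j * cofactor R j)                        ≡⟨ ∑-cong expand ⟩
  ∑ (λ j → xC j + ∑ (λ b → w b * (Y b j * cofactor R j)))
    ≡⟨ ∑-distrib-+ xC (λ j → ∑ (λ b → w b * (Y b j * cofactor R j))) ⟩
  ∑ xC + ∑ (λ j → ∑ (λ b → w b * (Y b j * cofactor R j)))
    ≡⟨ cong (λ t → ∑ xC + t) (∑-comm (λ j b → w b * (Y b j * cofactor R j))) ⟩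
  ∑ xC + ∑ (λ b → ∑ (λ j → w b * (Y b j * cofactor R j)))
    ≡⟨ cong₂ _+_ (det-∷ x R) (∑-cong λ b → trans (cong (w b *_) (det-∷ (Y b) R))
                                                  (*-distribˡ-∑ (w b) (λ j → Y b j * cofactor R j))) ⟨
  det (x ∷ R) + ∑ (λ b → w b * det (Y b ∷ R))         ∎
  where
  wY : Row (suc k)
  wY j = ∑ (λ b → w b * Y b j)
  z xC : Row (suc k)
  z j = x j + wY j
  xC j = x j * cofactor R j
  expand : ∀ j → z j * cofactor R j ≡ xC j + ∑ (λ b → w b * (Y b j * cofactor R j))
  expand j = trans (ℤ.*-distribʳ-+ (cofactor R j) (x j) (wY j))
    (cong (λ t → xC j + t) (trans (*-distribʳ-∑ (cofactor R j) (λ b → w b * Y b j))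
                                  (∑-cong λ b → ℤ.*-assoc (w b) (Y b j) (cofactor R j))))

private
  term-zeroˡ : ∀ s {x} d → x ≡ 0ℤ → s * (x * d) ≡ 0ℤ
  term-zeroˡ s d refl = ℤ.*-zeroʳ s

  term-zeroʳ : ∀ s x {d} → d ≡ 0ℤ → s * (x * d) ≡ 0ℤ
  term-zeroʳ s x refl = trans (cong (s *_) (ℤ.*-zeroʳ x)) (ℤ.*-zeroʳ s)

  Congruent : ∀ {k l} → ((Fin k → Fin l) → ℤ) → Set
  Congruent K = ∀ {f g} → f ≗ g → K f ≡ K g

  -- Laplace expansion along the first two rows; K f is the determinant of the
  -- remaining rows restricted to the columns f.
  expand₂ : ∀ {k} (u v : Row (suc (suc k))) → ((Fin k → Fin (suc (suc k))) → ℤ) → ℤ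
  expand₂ u v K = ∑ λ j → sign j * (u j * ∑ λ b → sign b * (v (punchIn j b) * K (punchIn j ∘ punchIn b)))

  withoutColumn₀ : ∀ {k} → ((Fin k → Fin (suc (suc k))) → ℤ) → Row (suc (suc k)) → ℤ
  withoutColumn₀ K w = ∑ λ b → sign b * (w (suc b) * K (suc ∘ punchIn b))

  withoutColumns₀ : ∀ {k} (u v : Row (suc (suc k))) → ((Fin k → Fin (suc (suc k))) → ℤ) → ℤ
  withoutColumns₀ u v K = ∑ λ j → sign j * (u (suc j) * ∑ λ b →
    sign b * (v (suc (punchIn j b)) * K (punchIn (suc j) ∘ punchIn (suc b))))

  expand₂-split : ∀ {k} (u v : Row (suc (suc k))) K →
    expand₂ u v K ≡ u zero * withoutColumn₀ K v + (- (v zero * withoutColumn₀ K u) + withoutColumns₀ u v K)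
  expand₂-split {k} u v K = cong₂ _+_ (ℤ.*-identityˡ (u zero * withoutColumn₀ K v)) (begin
    ∑ (λ j → (-1ℤ * sign j) * (u (suc j) * (1ℤ * (v zero * K₀ j) + ∑ (λ b → (-1ℤ * sign b) * V j b))))
      ≡⟨ ∑-cong (λ j → cong (λ t → (-1ℤ * sign j) * (u (suc j) * (1ℤ * (v zero * K₀ j) + t))) (negate j)) ⟩
    ∑ (λ j → (-1ℤ * sign j) * (u (suc j) * (1ℤ * (v zero * K₀ j) + -1ℤ * W j)))
      ≡⟨ ∑-cong (λ j → regroup (sign j) (u (suc j)) (v zero) (K₀ j) (W j)) ⟩
    ∑ (λ j → -1ℤ * (v zero * U j) + sign j * (u (suc j) * W j))
      ≡⟨ ∑-distrib-+ (λ j → -1ℤ * (v zero * U j)) (λ j → sign j * (u (suc j) * W j)) ⟩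
    ∑ (λ j → -1ℤ * (v zero * U j)) + withoutColumns₀ u v K
      ≡⟨ cong (_+ withoutColumns₀ u v K) (begin
           ∑ (λ j → -1ℤ * (v zero * U j))  ≡⟨ *-distribˡ-∑ -1ℤ (λ j → v zero * U j) ⟨
           -1ℤ * ∑ (λ j → v zero * U j)    ≡⟨ ℤ.-1*i≡-i _ ⟩
           - ∑ (λ j → v zero * U j)        ≡⟨ cong -_ (*-distribˡ-∑ (v zero) U) ⟨
           - (v zero * withoutColumn₀ K u) ∎) ⟩
    - (v zero * withoutColumn₀ K u) + withoutColumns₀ u v K ∎)
    where
    K₀ U : Fin (suc k) → ℤ
    K₀ j = K (suc ∘ punchIn j)
    U j = sign j * (u (suc j) * K₀ j)
    V : Fin (suc k) → Fin k → ℤ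
    V j b = v (suc (punchIn j b)) * K (punchIn (suc j) ∘ punchIn (suc b))
    W : Fin (suc k) → ℤ
    W j = ∑ (λ b → sign b * V j b)
    negate : ∀ j → ∑ (λ b → (-1ℤ * sign b) * V j b) ≡ -1ℤ * W j
    negate j = trans (∑-cong λ b → ℤ.*-assoc -1ℤ (sign b) (V j b)) (sym (*-distribˡ-∑ -1ℤ (λ b → sign b * V j b)))
    regroup : ∀ s u v κ t → (-1ℤ * s) * (u * (1ℤ * (v * κ) + -1ℤ * t)) ≡ -1ℤ * (v * (s * (u * κ))) + s * (u * t)
    regroup = solve-∀

  expand₂-antisym : ∀ {k} (u v : Row (suc (suc k))) K → Congruent K → expand₂ u v K ≡ - expand₂ v u K
  expand₂-antisym u v K K-cong = begin
    expand₂ u v K                                        ≡⟨ expand₂-split u v K ⟩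
    u zero * Xv + (- (v zero * Xu) + withoutColumns₀ u v K)
      ≡⟨ cong (λ t → u zero * Xv + (- (v zero * Xu) + t)) (rest-antisym u v K K-cong) ⟩
    u zero * Xv + (- (v zero * Xu) + - withoutColumns₀ v u K)
      ≡⟨ regroup (u zero) Xv (v zero) Xu (withoutColumns₀ v u K) ⟩
    - (v zero * Xu + (- (u zero * Xv) + withoutColumns₀ v u K))
      ≡⟨ cong -_ (expand₂-split v u K) ⟨
    - expand₂ v u K                                      ∎
    where
    Xu Xv : ℤ
    Xu = withoutColumn₀ K u
    Xv = withoutColumn₀ K v
    regroup : ∀ a x b y z → a * x + (- (b * y) + - z) ≡ - (b * y + (- (a * x) + z))
    regroup = solve-∀
    rest-antisym : ∀ {k} (u v : Row (suc (suc k))) K → Congruent K → withoutColumns₀ u v K ≡ - withoutColumns₀ v u K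
    rest-antisym {zero} u v K _ = trans (vanish u v) (cong -_ (sym (vanish v u)))
      where
      vanish : ∀ u v → withoutColumns₀ u v K ≡ 0ℤ
      vanish u v = ∑-zero λ j → term-zeroʳ (sign j) (u (suc j)) refl
    rest-antisym {suc k} u v K K-cong = begin
      withoutColumns₀ u v K            ≡⟨ shift u v ⟩
      expand₂ (u ∘ suc) (v ∘ suc) K′   ≡⟨ expand₂-antisym (u ∘ suc) (v ∘ suc) K′ K′-cong ⟩
      - expand₂ (v ∘ suc) (u ∘ suc) K′ ≡⟨ cong -_ (shift v u) ⟨
      - withoutColumns₀ v u K          ∎
      where
      K′ : (Fin k → Fin (suc (suc k))) → ℤ
      K′ = K ∘ lift 1
      K′-cong : Congruent K′
      K′-cong f≗g = K-cong λ { zero → refl ; (suc c) → cong suc (f≗g c) }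
      shift : ∀ u v → withoutColumns₀ u v K ≡ expand₂ (u ∘ suc) (v ∘ suc) K′
      shift u v = ∑-cong λ j → cong (λ t → sign j * (u (suc j) * t)) (∑-cong λ b →
        cong (λ t → sign b * (v (suc (punchIn j b)) * t)) (K-cong (columns j b)))
        where
        columns : ∀ j b → punchIn (suc j) ∘ punchIn (suc b) ≗ lift 1 (punchIn j ∘ punchIn b)
        columns j b zero    = refl
        columns j b (suc c) = refl

det-swap₀₁ : ∀ {k} (u v : Row (suc (suc k))) R → det (u ∷ v ∷ R) ≡ - det (v ∷ u ∷ R)
det-swap₀₁ u v R = expand₂-antisym u v (λ f → det (λ a c → R a (f c))) (λ f≗g → det-cong λ a c → cong (R a) (f≗g c))

private
  self-negating : ∀ {i} → i ≡ - i → i ≡ 0ℤ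
  self-negating {+ zero} _ = refl
  self-negating {+[1+ _ ]} ()
  self-negating { -[1+ _ ]} ()

det-equal₀₁ : ∀ {k} (u v : Row (suc (suc k))) R → u ≗ v → det (u ∷ v ∷ R) ≡ 0ℤ
det-equal₀₁ u v R u≗v = self-negating (begin
  det (u ∷ v ∷ R)    ≡⟨ det-swap₀₁ u v R ⟩
  - det (v ∷ u ∷ R)  ≡⟨ cong -_ (det-cong {M = v ∷ u ∷ R} {u ∷ v ∷ R} rows) ⟩
  - det (u ∷ v ∷ R)  ∎)
  where
  rows : ∀ a j → (v ∷ u ∷ R) a j ≡ (u ∷ v ∷ R) a j
  rows zero          j = sym (u≗v j)
  rows (suc zero)    j = u≗v j
  rows (suc (suc a)) j = refl

private
  Alternating : ℕ → Set
  Alternating k = ∀ (M : Matrix k) {a b} → a ≢ b → M a ≗ M b → det M ≡ 0ℤ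

  alternating-below₀ : ∀ {k} → Alternating k →
                       ∀ (M : Matrix (suc k)) {a b} → a ≢ b → M (suc a) ≗ M (suc b) → det M ≡ 0ℤ
  alternating-below₀ alt M a≢b rows =
    ∑-zero λ j → term-zeroʳ (sign j) (M zero j) (alt _ a≢b (rows ∘ punchIn j))

  alternating-with₀ : ∀ {k} → Alternating k → ∀ (M : Matrix (suc k)) b → M zero ≗ M (suc b) → det M ≡ 0ℤ
  alternating-with₀ {suc k} alt M zero    rows = det-equal₀₁ (M zero) (M (suc zero)) (λ a → M (suc (suc a))) rows
  alternating-with₀ {suc k} alt M (suc b) rows = begin
    det M                 ≡⟨ det-swap₀₁ (M zero) (M (suc zero)) rest ⟩
    - det swapped         ≡⟨ cong -_ (alternating-below₀ alt swapped {zero} {suc b} (λ ()) rows) ⟩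
    - 0ℤ                  ∎
    where
    rest : Fin k → Row (suc (suc k))
    rest a = M (suc (suc a))
    swapped : Matrix (suc (suc k))
    swapped = M (suc zero) ∷ M zero ∷ rest

det-alternating : ∀ {k} (M : Matrix k) {a b} → a ≢ b → M a ≗ M b → det M ≡ 0ℤ
det-alternating {suc k} M {zero}  {zero}  a≢b _    = contradiction refl a≢b
det-alternating {suc k} M {zero}  {suc b} _   rows = alternating-with₀ det-alternating M b rows
det-alternating {suc k} M {suc a} {zero}  _   rows = alternating-with₀ det-alternating M a (sym ∘ rows)
det-alternating {suc k} M {suc a} {suc b} a≢b rows = alternating-below₀ det-alternating M (a≢b ∘ cong suc) rows

det-addRowsToFirst : ∀ {k l} (x : Row (suc k)) (w : Fin l → ℤ) (ι : Fin l → Fin k) R →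
                     det ((λ j → x j + ∑ (λ b → w b * R (ι b) j)) ∷ R) ≡ det (x ∷ R)
det-addRowsToFirst x w ι R = begin
  det ((λ j → x j + ∑ (λ b → w b * R (ι b) j)) ∷ R)  ≡⟨ det-∷-∑ x w (R ∘ ι) R ⟩
  det (x ∷ R) + ∑ (λ b → w b * det (R (ι b) ∷ R))    ≡⟨ cong (λ t → det (x ∷ R) + t) (∑-zero vanish) ⟩
  det (x ∷ R) + 0ℤ                                   ≡⟨ ℤ.+-identityʳ _ ⟩
  det (x ∷ R)                                        ∎
  where
  vanish : ∀ b → w b * det (R (ι b) ∷ R) ≡ 0ℤ
  vanish b = trans (cong (w b *_) (det-alternating (R (ι b) ∷ R) {zero} {suc (ι b)} (λ ()) (λ _ → refl)))
                   (ℤ.*-zeroʳ (w b))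

det-addFirstToRows : ∀ {k} (x : Row (suc k)) (c : Fin k → ℤ) R →
                     det (x ∷ (λ a j → R a j + c a * x j)) ≡ det (x ∷ R)
det-addFirstToRows {zero}  x c R = refl
det-addFirstToRows {suc k} x c R = begin
  det (x ∷ R′ zero ∷ (R′ ∘ suc))          ≡⟨ det-swap₀₁ x (R′ zero) (R′ ∘ suc) ⟩
  - det (R′ zero ∷ x ∷ (R′ ∘ suc))        ≡⟨ cong -_ (det-∷-linear (R zero) x (c zero) (x ∷ (R′ ∘ suc))) ⟩
  - (det (R zero ∷ x ∷ (R′ ∘ suc)) + c zero * det (x ∷ x ∷ (R′ ∘ suc)))
    ≡⟨ cong (λ t → - (det (R zero ∷ x ∷ (R′ ∘ suc)) + c zero * t)) (det-equal₀₁ x x (R′ ∘ suc) (λ _ → refl)) ⟩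
  - (det (R zero ∷ x ∷ (R′ ∘ suc)) + c zero * 0ℤ)
    ≡⟨ cong -_ (trans (cong (λ t → det (R zero ∷ x ∷ (R′ ∘ suc)) + t) (ℤ.*-zeroʳ (c zero)))
                      (ℤ.+-identityʳ _)) ⟩
  - det (R zero ∷ x ∷ (R′ ∘ suc))         ≡⟨ cong -_ (det-∷-cong (R zero) {x ∷ (R′ ∘ suc)} {x ∷ (R ∘ suc)} minors) ⟩
  - det (R zero ∷ x ∷ (R ∘ suc))          ≡⟨ det-swap₀₁ x (R zero) (R ∘ suc) ⟨
  det (x ∷ R zero ∷ (R ∘ suc))            ∎
  where
  R′ : Fin (suc k) → Row (suc (suc k))
  R′ a j = R a j + c a * x j
  minors : ∀ j → cofactor (x ∷ (R′ ∘ suc)) j ≡ cofactor (x ∷ (R ∘ suc)) j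
  minors j = cong (sign j *_) (det-addFirstToRows (x ∘ punchIn j) (c ∘ suc) (λ a → R (suc a) ∘ punchIn j))

det-zeroColumn₀ : ∀ {k} (M : Matrix (suc k)) → (∀ a → M a zero ≡ 0ℤ) → det M ≡ 0ℤ
det-zeroColumn₀ {zero}  M col = cong (_+ 0ℤ) (term-zeroˡ 1ℤ 1ℤ (col zero))
det-zeroColumn₀ {suc k} M col = ∑-zero term
  where
  term : ∀ j → sign j * (M zero j * det (λ a b → M (suc a) (punchIn j b))) ≡ 0ℤ
  term zero    = term-zeroˡ 1ℤ _ (col zero)
  term (suc j) = term-zeroʳ (sign (suc j)) (M zero (suc j))
                   (det-zeroColumn₀ (λ a b → M (suc a) (punchIn (suc j) b)) (col ∘ suc))

det-column₀ : ∀ {k} (M : Matrix (suc k)) → (∀ a → M (suc a) zero ≡ 0ℤ) →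
              det M ≡ M zero zero * det (λ a b → M (suc a) (suc b))
det-column₀ {zero}  M _   = trans (ℤ.+-identityʳ _) (ℤ.*-identityˡ (M zero zero * 1ℤ))
det-column₀ {suc k} M col = begin
  1ℤ * (M zero zero * det (λ a b → M (suc a) (suc b))) + ∑ (λ j → term (suc j))
    ≡⟨ cong₂ _+_ (ℤ.*-identityˡ (M zero zero * det (λ a b → M (suc a) (suc b))))
                 (∑-zero λ j → term-zeroʳ (sign (suc j)) (M zero (suc j))
                   (det-zeroColumn₀ (λ a b → M (suc a) (punchIn (suc j) b)) col)) ⟩
  M zero zero * det (λ a b → M (suc a) (suc b)) + 0ℤ
    ≡⟨ ℤ.+-identityʳ _ ⟩
  M zero zero * det (λ a b → M (suc a) (suc b)) ∎
  where
  term : Fin (suc (suc k)) → ℤ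
  term j = sign j * (M zero j * det (λ a b → M (suc a) (punchIn j b)))

det-pivot : ∀ {k} (M : Matrix (suc k)) → M zero zero ≡ 1ℤ →
            det M ≡ det (λ a b → M (suc a) (suc b) - M (suc a) zero * M zero (suc b))
det-pivot {k} M pivot = begin
  det (M zero ∷ (M ∘ suc))                  ≡⟨ det-addFirstToRows (M zero) c (M ∘ suc) ⟨
  det (M zero ∷ M′)                         ≡⟨ det-column₀ (M zero ∷ M′) cleared ⟩
  M zero zero * det (λ a b → M′ a (suc b))  ≡⟨ cong₂ _*_ pivot (det-cong entries) ⟩
  1ℤ * det schur                            ≡⟨ ℤ.*-identityˡ _ ⟩
  det schur                                 ∎
  where
  c : Row k
  c a = - M (suc a) zero
  M′ : Fin k → Row (suc k)
  M′ a j = M (suc a) j + c a * M zero j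
  schur : Matrix k
  schur a b = M (suc a) (suc b) - M (suc a) zero * M zero (suc b)
  cleared : ∀ a → M′ a zero ≡ 0ℤ
  cleared a = begin
    M (suc a) zero + - M (suc a) zero * M zero zero  ≡⟨ cong (λ p → M (suc a) zero + - M (suc a) zero * p) pivot ⟩
    M (suc a) zero + - M (suc a) zero * 1ℤ          ≡⟨ cancel (M (suc a) zero) ⟩
    0ℤ ∎
    where
    cancel : ∀ y → y + - y * 1ℤ ≡ 0ℤ
    cancel = solve-∀
  entries : ∀ a b → M′ a (suc b) ≡ schur a b
  entries a b = rearrange (M (suc a) (suc b)) (M (suc a) zero) (M zero (suc b))
    where
    rearrange : ∀ x y z → x + - y * z ≡ x - y * z
    rearrange = solve-∀

det-scale : ∀ {k} c (M : Matrix k) → det (λ a j → c * M a j) ≡ c ^ k * det M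
det-scale {zero}  c M = refl
det-scale {suc k} c M = begin
  ∑ (λ j → sign j * ((c * M zero j) * det (λ a b → c * M (suc a) (punchIn j b))))
    ≡⟨ ∑-cong (λ j → cong (λ d → sign j * ((c * M zero j) * d)) (det-scale c (λ a b → M (suc a) (punchIn j b)))) ⟩
  ∑ (λ j → sign j * ((c * M zero j) * (c ^ k * D j)))
    ≡⟨ ∑-cong (λ j → regroup (sign j) c (M zero j) (c ^ k) (D j)) ⟩
  ∑ (λ j → (c * c ^ k) * (sign j * (M zero j * D j)))
    ≡⟨ *-distribˡ-∑ (c * c ^ k) (λ j → sign j * (M zero j * D j)) ⟨
  c * c ^ k * det M ∎
  where
  D : Fin (suc k) → ℤ
  D j = det (λ a b → M (suc a) (punchIn j b))
  regroup : ∀ s c x p d → s * ((c * x) * (p * d)) ≡ (c * p) * (s * (x * d))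
  regroup = solve-∀

scalarMatrix : ∀ {k} → ℤ → Matrix k
scalarMatrix x i j = if i == j then x else 0ℤ

identity : ∀ {k} → Matrix k
identity = scalarMatrix 1ℤ

scalarMatrix-suc : ∀ {k} x (i j : Fin k) → scalarMatrix x (suc i) (suc j) ≡ scalarMatrix x i j
scalarMatrix-suc x i j = cong (if_then x else 0ℤ) (==-injective suc suc-injective i j)

scalarMatrix-sym : ∀ {k} x (i j : Fin k) → scalarMatrix x i j ≡ scalarMatrix x j i
scalarMatrix-sym x i j = cong (if_then x else 0ℤ) (==-sym i j)

scalarMatrix≡*identity : ∀ {k} x (i j : Fin k) → scalarMatrix x i j ≡ x * identity i j
scalarMatrix≡*identity x i j with i == j
... | true  = sym (ℤ.*-identityʳ x)
... | false = sym (ℤ.*-zeroʳ x)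

det-scalarMatrix : ∀ k x → det (scalarMatrix {k} x) ≡ x ^ k
det-scalarMatrix zero    x = refl
det-scalarMatrix (suc k) x = begin
  det (scalarMatrix {suc k} x)                      ≡⟨ det-column₀ (scalarMatrix {suc k} x) (λ _ → refl) ⟩
  x * det (λ (a b : Fin k) → scalarMatrix x (suc a) (suc b))  ≡⟨ cong (x *_) (det-cong (scalarMatrix-suc {k} x)) ⟩
  x * det (scalarMatrix {k} x)                      ≡⟨ cong (x *_) (det-scalarMatrix k x) ⟩
  x * x ^ k                                         ∎

∑-scalarMatrixʳ : ∀ {k} (f : Fin k → ℤ) x j → ∑ (λ e → f e * scalarMatrix x e j) ≡ f j * x
∑-scalarMatrixʳ f x zero = begin
  f zero * x + ∑ (λ e → f (suc e) * 0ℤ)  ≡⟨ cong (λ t → f zero * x + t) (∑-zero (ℤ.*-zeroʳ ∘ f ∘ suc)) ⟩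
  f zero * x + 0ℤ                        ≡⟨ ℤ.+-identityʳ _ ⟩
  f zero * x                             ∎
∑-scalarMatrixʳ f x (suc j) = begin
  f zero * 0ℤ + ∑ (λ e → f (suc e) * scalarMatrix x (suc e) (suc j))
    ≡⟨ cong₂ _+_ (ℤ.*-zeroʳ (f zero)) (∑-cong λ e → cong (f (suc e) *_) (scalarMatrix-suc x e j)) ⟩
  0ℤ + ∑ (λ e → f (suc e) * scalarMatrix x e j)  ≡⟨ ℤ.+-identityˡ _ ⟩
  ∑ (λ e → f (suc e) * scalarMatrix x e j)       ≡⟨ ∑-scalarMatrixʳ (f ∘ suc) x j ⟩
  f (suc j) * x                                  ∎

∑-scalarMatrix-column : ∀ {k} x (j : Fin k) → ∑ (λ i → scalarMatrix x i j) ≡ x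
∑-scalarMatrix-column x j = begin
  ∑ (λ i → scalarMatrix x i j)         ≡⟨ ∑-cong (λ i → ℤ.*-identityˡ (scalarMatrix x i j)) ⟨
  ∑ (λ i → 1ℤ * scalarMatrix x i j)    ≡⟨ ∑-scalarMatrixʳ (λ _ → 1ℤ) x j ⟩
  1ℤ * x                               ≡⟨ ℤ.*-identityˡ x ⟩
  x                                    ∎

-- Block matrices

↑-cases : ∀ m {n} (P : Fin (m +ℕ n) → Set) → (∀ i → P (i ↑ˡ n)) → (∀ q → P (m ↑ʳ q)) → ∀ a → P a
↑-cases zero    P _    right a       = right a
↑-cases (suc m) P left _     zero    = left zero
↑-cases (suc m) P left right (suc a) = ↑-cases m (P ∘ suc) (left ∘ suc) right a

∑-↑ : ∀ m {n} (f : Fin (m +ℕ n) → ℤ) → ∑ f ≡ ∑ (λ i → f (i ↑ˡ n)) + ∑ (λ q → f (m ↑ʳ q))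
∑-↑ zero    f = sym (ℤ.+-identityˡ (∑ f))
∑-↑ (suc m) {n} f = trans (cong (λ t → f zero + t) (∑-↑ m (f ∘ suc)))
                      (sym (ℤ.+-assoc (f zero) (∑ (λ i → f (suc (i ↑ˡ n)))) (∑ (λ q → f (suc (m ↑ʳ q))))))

punchIn-↑ˡ : ∀ {m} n (j : Fin (suc m)) (b : Fin m) → punchIn (j ↑ˡ n) (b ↑ˡ n) ≡ punchIn j b ↑ˡ n
punchIn-↑ˡ n zero    b       = refl
punchIn-↑ˡ n (suc j) zero    = refl
punchIn-↑ˡ n (suc j) (suc b) = cong suc (punchIn-↑ˡ n j b)

punchIn-↑ʳ : ∀ {m} n (j : Fin (suc m)) (q : Fin n) → punchIn (j ↑ˡ n) (m ↑ʳ q) ≡ suc m ↑ʳ q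
punchIn-↑ʳ         n zero    q = refl
punchIn-↑ʳ {suc m} n (suc j) q = cong suc (punchIn-↑ʳ n j q)

↑ˡ≢↑ʳ : ∀ {m n} (i : Fin m) (q : Fin n) → i ↑ˡ n ≢ m ↑ʳ q
↑ˡ≢↑ʳ {m} {n} i q eq with trans (sym (splitAt-↑ˡ m i n)) (trans (cong (splitAt m) eq) (splitAt-↑ʳ m n q))
... | ()

det-blockLowerTriangular : ∀ m {n} (M : Matrix (m +ℕ n)) → (∀ i q → M (i ↑ˡ n) (m ↑ʳ q) ≡ 0ℤ) →
  det M ≡ det (λ i j → M (i ↑ˡ n) (j ↑ˡ n)) * det (λ p q → M (m ↑ʳ p) (m ↑ʳ q))
det-blockLowerTriangular zero    M _     = sym (ℤ.*-identityˡ (det M))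
det-blockLowerTriangular (suc m) {n} M upper = begin
  ∑ term                                                  ≡⟨ ∑-↑ (suc m) term ⟩
  ∑ (λ i → term (i ↑ˡ n)) + ∑ (λ q → term (suc m ↑ʳ q))  ≡⟨ cong₂ _+_ (∑-cong left) (∑-zero right) ⟩
  ∑ (λ i → expandA i * det D) + 0ℤ                        ≡⟨ ℤ.+-identityʳ _ ⟩
  ∑ (λ i → expandA i * det D)                             ≡⟨ *-distribʳ-∑ (det D) expandA ⟨
  det A * det D                                           ∎
  where
  A : Matrix (suc m)
  A i j = M (i ↑ˡ n) (j ↑ˡ n)
  D : Matrix n
  D p q = M (suc m ↑ʳ p) (suc m ↑ʳ q)
  term : Fin (suc m +ℕ n) → ℤ
  term j = sign j * (M zero j * det (λ a b → M (suc a) (punchIn j b)))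
  expandA : Fin (suc m) → ℤ
  expandA i = sign i * (A zero i * det (λ a b → A (suc a) (punchIn i b)))
  minor : ∀ i → det (λ a b → M (suc a) (punchIn (i ↑ˡ n) b)) ≡ det (λ a b → A (suc a) (punchIn i b)) * det D
  minor i = begin
    det (λ a b → M (suc a) (punchIn (i ↑ˡ n) b))
      ≡⟨ det-blockLowerTriangular m _ (λ a q → trans (cong (M (suc (a ↑ˡ n))) (punchIn-↑ʳ n i q)) (upper (suc a) q)) ⟩
    det (λ a b → M (suc (a ↑ˡ n)) (punchIn (i ↑ˡ n) (b ↑ˡ n))) * det (λ p q → M (suc m ↑ʳ p) (punchIn (i ↑ˡ n) (m ↑ʳ q)))
      ≡⟨ cong₂ _*_ (det-cong λ a b → cong (M (suc (a ↑ˡ n))) (punchIn-↑ˡ n i b))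
                   (det-cong λ p q → cong (M (suc m ↑ʳ p)) (punchIn-↑ʳ n i q)) ⟩
    det (λ a b → A (suc a) (punchIn i b)) * det D ∎
  left : ∀ i → term (i ↑ˡ n) ≡ expandA i * det D
  left i = begin
    sign (i ↑ˡ n) * (A zero i * det (λ a b → M (suc a) (punchIn (i ↑ˡ n) b)))
      ≡⟨ cong₂ (λ s d → s * (A zero i * d)) (cong (-1ℤ ^_) (toℕ-↑ˡ i n)) (minor i) ⟩
    sign i * (A zero i * (det (λ a b → A (suc a) (punchIn i b)) * det D))
      ≡⟨ regroup (sign i) (A zero i) _ (det D) ⟩
    expandA i * det D ∎
    where
    regroup : ∀ s a d e → s * (a * (d * e)) ≡ s * (a * d) * e
    regroup = solve-∀
  right : ∀ q → term (suc m ↑ʳ q) ≡ 0ℤ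
  right q = term-zeroˡ (sign (suc m ↑ʳ q)) _ (upper zero q)

det-scaleUpperRows : ∀ m {n} x (M N : Matrix (m +ℕ n)) →
  (∀ i j → N (i ↑ˡ n) j ≡ x * M (i ↑ˡ n) j) → (∀ p j → N (m ↑ʳ p) j ≡ M (m ↑ʳ p) j) →
  det N ≡ x ^ m * det M
det-scaleUpperRows zero    x M N _     lower = trans (det-cong lower) (sym (ℤ.*-identityˡ (det M)))
det-scaleUpperRows (suc m) {n} x M N upper lower = begin
  ∑ (λ j → sign j * (N zero j * det (λ a b → N (suc a) (punchIn j b))))
    ≡⟨ ∑-cong (λ j → cong₂ (λ y d → sign j * (y * d)) (upper zero j) (minors j)) ⟩
  ∑ (λ j → sign j * ((x * M zero j) * (x ^ m * minor j)))
    ≡⟨ ∑-cong (λ j → regroup (sign j) x (M zero j) (x ^ m) (minor j)) ⟩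
  ∑ (λ j → (x * x ^ m) * (sign j * (M zero j * minor j)))
    ≡⟨ *-distribˡ-∑ (x * x ^ m) (λ j → sign j * (M zero j * minor j)) ⟨
  x * x ^ m * det M ∎
  where
  minor : Fin (suc m +ℕ n) → ℤ
  minor j = det (λ a b → M (suc a) (punchIn j b))
  minors : ∀ j → det (λ a b → N (suc a) (punchIn j b)) ≡ x ^ m * minor j
  minors j = det-scaleUpperRows m x (λ a b → M (suc a) (punchIn j b)) (λ a b → N (suc a) (punchIn j b))
                                (λ i b → upper (suc i) (punchIn j b)) (λ p b → lower p (punchIn j b))
  regroup : ∀ s c y p d → s * ((c * y) * (p * d)) ≡ (c * p) * (s * (y * d))
  regroup = solve-∀

det-addLowerRows : ∀ m {n} (W : Fin m → Fin n → ℤ) (M N : Matrix (m +ℕ n)) →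
  (∀ i j → N (i ↑ˡ n) j ≡ M (i ↑ˡ n) j + ∑ (λ q → W i q * M (m ↑ʳ q) j)) →
  (∀ p j → N (m ↑ʳ p) j ≡ M (m ↑ʳ p) j) →
  det N ≡ det M
det-addLowerRows zero    W M N _     lower = det-cong lower
det-addLowerRows (suc m) {n} W M N upper lower = begin
  det (N zero ∷ (N ∘ suc))  ≡⟨ det-∷-congˡ first (N ∘ suc) ⟩
  det (N₀ ∷ (N ∘ suc))      ≡⟨ det-addRowsToFirst (M zero) (W zero) (m ↑ʳ_) (N ∘ suc) ⟩
  det (M zero ∷ (N ∘ suc))  ≡⟨ det-∷-cong (M zero) {N ∘ suc} {M ∘ suc} minors ⟩
  det M                     ∎
  where
  N₀ : Row (suc m +ℕ n)
  N₀ j = M zero j + ∑ (λ q → W zero q * N (suc (m ↑ʳ q)) j)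
  first : N zero ≗ N₀
  first j = trans (upper zero j) (cong (λ t → M zero j + t) (∑-cong λ q → cong (W zero q *_) (sym (lower q j))))
  minors : ∀ j → cofactor (N ∘ suc) j ≡ cofactor (M ∘ suc) j
  minors j = cong (sign j *_)
    (det-addLowerRows m (W ∘ suc) (λ a b → M (suc a) (punchIn j b)) (λ a b → N (suc a) (punchIn j b))
                      (λ i b → upper (suc i) (punchIn j b)) (λ p b → lower p (punchIn j b)))

det-schurComplement : ∀ m {n} (M : Matrix (m +ℕ n)) → (∀ i j → M (i ↑ˡ n) (j ↑ˡ n) ≡ identity i j) →
  det M ≡ det (λ p q → M (m ↑ʳ p) (m ↑ʳ q) - ∑ (λ e → M (m ↑ʳ p) (e ↑ˡ n) * M (e ↑ˡ n) (m ↑ʳ q)))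
det-schurComplement zero    M _   = det-cong λ p q → sym (ℤ.+-identityʳ (M p q))
det-schurComplement (suc m) {n} M top = begin
  det M                                             ≡⟨ det-pivot M (top zero zero) ⟩
  det M′                                            ≡⟨ det-schurComplement m M′ top′ ⟩
  det (λ p q → M′ (m ↑ʳ p) (m ↑ʳ q) - ∑ (λ e → M′ (m ↑ʳ p) (e ↑ˡ n) * M′ (e ↑ˡ n) (m ↑ʳ q)))
                                                    ≡⟨ det-cong entries ⟩
  det (λ p q → M (suc m ↑ʳ p) (suc m ↑ʳ q) - ∑ (λ e → M (suc m ↑ʳ p) (e ↑ˡ n) * M (e ↑ˡ n) (suc m ↑ʳ q))) ∎
  where
  M′ : Matrix (m +ℕ n)
  M′ a b = M (suc a) (suc b) - M (suc a) zero * M zero (suc b)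
  drop : ∀ x y z → y ≡ 0ℤ → x - y * z ≡ x
  drop x y z refl = ℤ.+-identityʳ x
  drop′ : ∀ x y z → z ≡ 0ℤ → x - y * z ≡ x
  drop′ x y z z≡0 = trans (cong (λ t → x - t) (trans (cong (y *_) z≡0) (ℤ.*-zeroʳ y))) (ℤ.+-identityʳ x)
  top′ : ∀ i j → M′ (i ↑ˡ n) (j ↑ˡ n) ≡ identity i j
  top′ i j = begin
    M (suc i ↑ˡ n) (suc j ↑ˡ n) - M (suc i ↑ˡ n) zero * M zero (suc j ↑ˡ n)
      ≡⟨ drop (M (suc i ↑ˡ n) (suc j ↑ˡ n)) (M (suc i ↑ˡ n) zero) (M zero (suc j ↑ˡ n)) (top (suc i) zero) ⟩
    M (suc i ↑ˡ n) (suc j ↑ˡ n)    ≡⟨ top (suc i) (suc j) ⟩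
    identity (suc i) (suc j)       ≡⟨ scalarMatrix-suc 1ℤ i j ⟩
    identity i j                   ∎
  entries : ∀ p q → M′ (m ↑ʳ p) (m ↑ʳ q) - ∑ (λ e → M′ (m ↑ʳ p) (e ↑ˡ n) * M′ (e ↑ˡ n) (m ↑ʳ q))
                  ≡ M (suc m ↑ʳ p) (suc m ↑ʳ q) - ∑ (λ e → M (suc m ↑ʳ p) (e ↑ˡ n) * M (e ↑ˡ n) (suc m ↑ʳ q))
  entries p q = begin
    (d - c₀ * b₀) - ∑ (λ e → M′ (m ↑ʳ p) (e ↑ˡ n) * M′ (e ↑ˡ n) (m ↑ʳ q))
      ≡⟨ cong (λ t → (d - c₀ * b₀) - t) (∑-cong λ e →
           cong₂ _*_ (drop′ (c (suc e)) c₀ (M zero (suc e ↑ˡ n)) (top zero (suc e)))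
                     (drop (b (suc e)) (M (suc e ↑ˡ n) zero) b₀ (top (suc e) zero))) ⟩
    (d - c₀ * b₀) - ∑ (λ e → c (suc e) * b (suc e))
      ≡⟨ regroup d (c₀ * b₀) (∑ (λ e → c (suc e) * b (suc e))) ⟩
    d - (c₀ * b₀ + ∑ (λ e → c (suc e) * b (suc e))) ∎
    where
    d c₀ b₀ : ℤ
    d  = M (suc m ↑ʳ p) (suc m ↑ʳ q)
    c₀ = M (suc m ↑ʳ p) zero
    b₀ = M zero (suc m ↑ʳ q)
    c : Fin (suc m) → ℤ
    c e = M (suc m ↑ʳ p) (e ↑ˡ n)
    b : Fin (suc m) → ℤ
    b e = M (e ↑ˡ n) (suc m ↑ʳ q)
    regroup : ∀ d x s → (d - x) - s ≡ d - (x + s)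
    regroup = solve-∀

_*ᴹ_ : ∀ {k l o} → (Fin k → Fin l → ℤ) → (Fin l → Fin o → ℤ) → Fin k → Fin o → ℤ
(B *ᴹ C) i j = ∑ (λ e → B i e * C e j)

fromBlocks : ∀ {m n} → Matrix m → (Fin m → Fin n → ℤ) → (Fin n → Fin m → ℤ) → Matrix n → Matrix (m +ℕ n)
fromBlocks A B C D = (λ i → A i ++ B i) ++ (λ p → C p ++ D p)

module FromBlocks {m n} (A : Matrix m) (B : Fin m → Fin n → ℤ) (C : Fin n → Fin m → ℤ) (D : Matrix n) where
  private
    M : Matrix (m +ℕ n)
    M = fromBlocks A B C D
    upper : Fin m → Row (m +ℕ n)
    upper i = A i ++ B i
    lower : Fin n → Row (m +ℕ n)
    lower p = C p ++ D p

  ↑ˡ-↑ˡ : ∀ i j → M (i ↑ˡ n) (j ↑ˡ n) ≡ A i j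
  ↑ˡ-↑ˡ i j = trans (cong-app (lookup-++ˡ upper lower i) (j ↑ˡ n)) (lookup-++ˡ (A i) (B i) j)

  ↑ˡ-↑ʳ : ∀ i q → M (i ↑ˡ n) (m ↑ʳ q) ≡ B i q
  ↑ˡ-↑ʳ i q = trans (cong-app (lookup-++ˡ upper lower i) (m ↑ʳ q)) (lookup-++ʳ (A i) (B i) q)

  ↑ʳ-↑ˡ : ∀ p j → M (m ↑ʳ p) (j ↑ˡ n) ≡ C p j
  ↑ʳ-↑ˡ p j = trans (cong-app (lookup-++ʳ upper lower p) (j ↑ˡ n)) (lookup-++ˡ (C p) (D p) j)

  ↑ʳ-↑ʳ : ∀ p q → M (m ↑ʳ p) (m ↑ʳ q) ≡ D p q
  ↑ʳ-↑ʳ p q = trans (cong-app (lookup-++ʳ upper lower p) (m ↑ʳ q)) (lookup-++ʳ (C p) (D p) q)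

  lower-rows : ∀ A′ B′ p → M (m ↑ʳ p) ≗ fromBlocks A′ B′ C D (m ↑ʳ p)
  lower-rows A′ B′ p j = trans (cong-app (lookup-++ʳ upper lower p) j)
                               (sym (cong-app (lookup-++ʳ (λ i → A′ i ++ B′ i) (λ p → C p ++ D p) p) j))

-- Both sides equal the determinant of [[x I, x B], [C, x I]]: dividing its upper rows by x gives
-- [[I, B], [C, x I]] with Schur complement x I - C B, and eliminating x B with the lower rows gives
-- the block-triangular [[x I - B C, 0], [C, x I]].
sylvester : ∀ {m n} (B : Fin m → Fin n → ℤ) (C : Fin n → Fin m → ℤ) x →
  x ^ m * det (λ p q → scalarMatrix x p q - (C *ᴹ B) p q) ≡ x ^ n * det (λ e f → scalarMatrix x e f - (B *ᴹ C) e f)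
sylvester {m} {n} B C x = begin
  x ^ m * det (λ p q → scalarMatrix x p q - (C *ᴹ B) p q)  ≡⟨ cong (x ^ m *_) schur ⟨
  x ^ m * det M₀                                           ≡⟨ det-scaleUpperRows m x M₀ M₁ scaled (E₁.lower-rows _ _) ⟨
  det M₁                                                   ≡⟨ det-addLowerRows m (λ i q → - B i q) M₁ M₂ eliminate (E₂.lower-rows _ _) ⟨
  det M₂                                                   ≡⟨ det-blockLowerTriangular m M₂ E₂.↑ˡ-↑ʳ ⟩
  det (λ e f → M₂ (e ↑ˡ n) (f ↑ˡ n)) * det (λ p q → M₂ (m ↑ʳ p) (m ↑ʳ q))
    ≡⟨ cong₂ _*_ (det-cong E₂.↑ˡ-↑ˡ) (trans (det-cong E₂.↑ʳ-↑ʳ) (det-scalarMatrix n x)) ⟩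
  det xI-BC * x ^ n                                        ≡⟨ ℤ.*-comm (det xI-BC) (x ^ n) ⟩
  x ^ n * det xI-BC                                        ∎
  where
  xI-BC : Matrix m
  xI-BC e f = scalarMatrix x e f - (B *ᴹ C) e f
  M₀ M₁ M₂ : Matrix (m +ℕ n)
  M₀ = fromBlocks identity B C (scalarMatrix x)
  M₁ = fromBlocks (scalarMatrix x) (λ i q → x * B i q) C (scalarMatrix x)
  M₂ = fromBlocks xI-BC (λ _ _ → 0ℤ) C (scalarMatrix x)
  module E₀ = FromBlocks identity B C (scalarMatrix x)
  module E₁ = FromBlocks (scalarMatrix x) (λ i q → x * B i q) C (scalarMatrix x)
  module E₂ = FromBlocks xI-BC (λ _ _ → 0ℤ) C (scalarMatrix x)

  schur : det M₀ ≡ det (λ p q → scalarMatrix x p q - (C *ᴹ B) p q)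
  schur = trans (det-schurComplement m M₀ E₀.↑ˡ-↑ˡ)
    (det-cong λ p q → cong₂ _-_ (E₀.↑ʳ-↑ʳ p q) (∑-cong λ e → cong₂ _*_ (E₀.↑ʳ-↑ˡ p e) (E₀.↑ˡ-↑ʳ e q)))

  scaled : ∀ i j → M₁ (i ↑ˡ n) j ≡ x * M₀ (i ↑ˡ n) j
  scaled i = ↑-cases m (λ j → M₁ (i ↑ˡ n) j ≡ x * M₀ (i ↑ˡ n) j)
    (λ j → begin
      M₁ (i ↑ˡ n) (j ↑ˡ n)      ≡⟨ E₁.↑ˡ-↑ˡ i j ⟩
      scalarMatrix x i j        ≡⟨ scalarMatrix≡*identity x i j ⟩
      x * identity i j          ≡⟨ cong (x *_) (E₀.↑ˡ-↑ˡ i j) ⟨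
      x * M₀ (i ↑ˡ n) (j ↑ˡ n)  ∎)
    (λ q → trans (E₁.↑ˡ-↑ʳ i q) (cong (x *_) (sym (E₀.↑ˡ-↑ʳ i q))))

  eliminate : ∀ i j → M₂ (i ↑ˡ n) j ≡ M₁ (i ↑ˡ n) j + ∑ (λ q → - B i q * M₁ (m ↑ʳ q) j)
  eliminate i = ↑-cases m (λ j → M₂ (i ↑ˡ n) j ≡ M₁ (i ↑ˡ n) j + ∑ (λ q → - B i q * M₁ (m ↑ʳ q) j))
    (λ f → begin
      M₂ (i ↑ˡ n) (f ↑ˡ n)                                ≡⟨ E₂.↑ˡ-↑ˡ i f ⟩
      scalarMatrix x i f + - ∑ (λ q → B i q * C q f)      ≡⟨ cong (λ t → scalarMatrix x i f + t) (∑-neg (λ q → B i q * C q f)) ⟨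
      scalarMatrix x i f + ∑ (λ q → - (B i q * C q f))    ≡⟨ cong₂ _+_ (sym (E₁.↑ˡ-↑ˡ i f)) (∑-cong λ q →
                                                               trans (ℤ.neg-distribˡ-* (B i q) (C q f))
                                                                     (cong (- B i q *_) (sym (E₁.↑ʳ-↑ˡ q f)))) ⟩
      M₁ (i ↑ˡ n) (f ↑ˡ n) + ∑ (λ q → - B i q * M₁ (m ↑ʳ q) (f ↑ˡ n)) ∎)
    (λ q′ → begin
      M₂ (i ↑ˡ n) (m ↑ʳ q′)                                 ≡⟨ E₂.↑ˡ-↑ʳ i q′ ⟩
      0ℤ                                                    ≡⟨ cancel x (B i q′) ⟨
      x * B i q′ + - B i q′ * x                             ≡⟨ cong (λ t → x * B i q′ + t) (∑-scalarMatrixʳ (λ q → - B i q) x q′) ⟨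
      x * B i q′ + ∑ (λ q → - B i q * scalarMatrix x q q′)  ≡⟨ cong₂ _+_ (sym (E₁.↑ˡ-↑ʳ i q′))
                                                                 (∑-cong λ q → cong (- B i q *_) (sym (E₁.↑ʳ-↑ʳ q q′))) ⟩
      M₁ (i ↑ˡ n) (m ↑ʳ q′) + ∑ (λ q → - B i q * M₁ (m ↑ʳ q) (m ↑ʳ q′)) ∎)
    where
    cancel : ∀ x b → x * b + - b * x ≡ 0ℤ
    cancel = solve-∀

-- Matrices with constant column sums

det-columnSums : ∀ {k} (X : Matrix (suc k)) s → (∀ j → ∑ (λ i → X i j) ≡ s) →
                 det X ≡ s * det ((λ _ → 1ℤ) ∷ (X ∘ suc))
det-columnSums {k} X s sums = begin
  det (X zero ∷ (X ∘ suc))            ≡⟨ det-addRowsToFirst (X zero) (λ _ → 1ℤ) (λ b → b) (X ∘ suc) ⟨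
  det (total ∷ (X ∘ suc))             ≡⟨ det-∷-congˡ total≡s (X ∘ suc) ⟩
  det ((λ _ → s * 1ℤ) ∷ (X ∘ suc))    ≡⟨ det-∷-scale s (λ _ → 1ℤ) (X ∘ suc) ⟩
  s * det ((λ _ → 1ℤ) ∷ (X ∘ suc))    ∎
  where
  total : Row (suc k)
  total j = X zero j + ∑ (λ b → 1ℤ * X (suc b) j)
  total≡s : ∀ j → total j ≡ s * 1ℤ
  total≡s j = begin
    X zero j + ∑ (λ b → 1ℤ * X (suc b) j)  ≡⟨ cong (λ t → X zero j + t) (∑-cong λ b → ℤ.*-identityˡ (X (suc b) j)) ⟩
    ∑ (λ i → X i j)                        ≡⟨ sums j ⟩
    s                                      ≡⟨ ℤ.*-identityʳ s ⟨
    s * 1ℤ                                 ∎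

-- Adding all rows to the first one turns it into c (1, …, 1) in X and into (c - k) (1, …, 1) in
-- X minus the all-ones matrix J; against the all-ones first row, J is then eliminated.
det-minusOnes : ∀ {k} (X : Matrix k) c → (∀ j → ∑ (λ i → X i j) ≡ c) →
                c * det (λ i j → X i j - 1ℤ) ≡ (c - + k) * det X
det-minusOnes {zero}  X c _    = trans (ℤ.*-identityʳ c) (sym (trans (ℤ.*-identityʳ (c - + 0)) (ℤ.+-identityʳ c)))
det-minusOnes {suc k} X c sums = begin
  c * det Y                                     ≡⟨ cong (c *_) (det-columnSums Y (c - + suc k) sumsY) ⟩
  c * ((c - + suc k) * det (ones ∷ (Y ∘ suc)))  ≡⟨ cong (λ d → c * ((c - + suc k) * d))
                                                         (det-addFirstToRows ones (λ _ → -1ℤ) (X ∘ suc)) ⟩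
  c * ((c - + suc k) * det (ones ∷ (X ∘ suc)))  ≡⟨ swap c (c - + suc k) _ ⟩
  (c - + suc k) * (c * det (ones ∷ (X ∘ suc)))  ≡⟨ cong ((c - + suc k) *_) (det-columnSums X c sums) ⟨
  (c - + suc k) * det X                         ∎
  where
  ones : Row (suc k)
  ones _ = 1ℤ
  Y : Matrix (suc k)
  Y i j = X i j - 1ℤ
  sumsY : ∀ j → ∑ (λ i → Y i j) ≡ c - + suc k
  sumsY j = begin
    ∑ (λ i → X i j - 1ℤ)                     ≡⟨ ∑-distrib-+ (λ i → X i j) (λ _ → -1ℤ) ⟩
    ∑ (λ i → X i j) + ∑ {suc k} (λ _ → -1ℤ)  ≡⟨ cong₂ _+_ (sums j) (∑-const (suc k) -1ℤ) ⟩
    c + + suc k * -1ℤ                        ≡⟨ negate c (+ suc k) ⟩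
    c - + suc k                              ∎
    where
    negate : ∀ c k → c + k * -1ℤ ≡ c - k
    negate = solve-∀
  swap : ∀ c d e → c * (d * e) ≡ d * (c * e)
  swap = solve-∀

-- Characteristic polynomials of digraphs

-1^n*-1^n≡1 : ∀ n → -1ℤ ^ n * -1ℤ ^ n ≡ 1ℤ
-1^n*-1^n≡1 zero    = refl
-1^n*-1^n≡1 (suc n) = trans (square (-1ℤ ^ n)) (-1^n*-1^n≡1 n)
  where
  square : ∀ s → (-1ℤ * s) * (-1ℤ * s) ≡ s * s
  square = solve-∀

[-x-1]^k : ∀ x k → (- x - 1ℤ) ^ k ≡ -1ℤ ^ k * (x + 1ℤ) ^ k
[-x-1]^k x zero    = refl
[-x-1]^k x (suc k) = trans (cong ((- x - 1ℤ) *_) ([-x-1]^k x k)) (regroup x (-1ℤ ^ k) ((x + 1ℤ) ^ k))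
  where
  regroup : ∀ x s p → (- x - 1ℤ) * (s * p) ≡ (-1ℤ * s) * ((x + 1ℤ) * p)
  regroup = solve-∀

charPoly-edgeless : ∀ {k} (G : Rel k) x → charPoly (apply o0 G) x ≡ x ^ k
charPoly-edgeless {k} G x = trans (det-cong {k} λ i j → ℤ.+-identityʳ (scalarMatrix x i j))
                                  (det-scalarMatrix k x)

charPoly-complete : ∀ {k} (G : Rel k) x → (x + 1ℤ) * charPoly (apply o1 G) x ≡ (x - + k + 1ℤ) * (x + 1ℤ) ^ k
charPoly-complete {k} G x = begin
  (x + 1ℤ) * charPoly (apply o1 G) x
    ≡⟨ cong ((x + 1ℤ) *_) (det-cong entries) ⟩
  (x + 1ℤ) * det (λ (i j : Fin k) → scalarMatrix (x + 1ℤ) i j - 1ℤ)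
    ≡⟨ det-minusOnes (scalarMatrix (x + 1ℤ)) (x + 1ℤ) (∑-scalarMatrix-column (x + 1ℤ)) ⟩
  (x + 1ℤ - + k) * det (scalarMatrix {k} (x + 1ℤ))
    ≡⟨ cong₂ _*_ (rearrange x (+ k)) (det-scalarMatrix k (x + 1ℤ)) ⟩
  (x - + k + 1ℤ) * (x + 1ℤ) ^ k ∎
  where
  entries : ∀ i j → scalarMatrix x i j - adjMatrix (apply o1 G) i j ≡ scalarMatrix (x + 1ℤ) i j - 1ℤ
  entries i j with i == j
  ... | true  = shift x
    where
    shift : ∀ x → x - 0ℤ ≡ x + 1ℤ - 1ℤ
    shift = solve-∀
  ... | false = refl
  rearrange : ∀ x k → x + 1ℤ - k ≡ x - k + 1ℤ
  rearrange = solve-∀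

charPoly-complement : ∀ {k} (G : Rel k) → Loopless G → ∀ r → (∀ j → indeg G j ≡ r) → ∀ x →
  (x + + r + 1ℤ) * charPoly (apply o- G) x ≡ (-1ℤ ^ k) * (x - + k + + r + 1ℤ) * charPoly G (- x - 1ℤ)
charPoly-complement {k} G loopless r indeg≡r x = begin
  (x + + r + 1ℤ) * charPoly (apply o- G) x
    ≡⟨ cong₂ _*_ (reorder x (+ r)) (det-cong complementEntries) ⟩
  c * det (λ i j → X i j - 1ℤ)
    ≡⟨ det-minusOnes X c columnSums ⟩
  (c - + k) * det X
    ≡⟨ ℤ.*-identityˡ _ ⟨
  1ℤ * ((c - + k) * det X)
    ≡⟨ cong (_* ((c - + k) * det X)) (-1^n*-1^n≡1 k) ⟨
  (s * s) * ((c - + k) * det X)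
    ≡⟨ regroup s x (+ k) (+ r) (det X) ⟩
  s * (x - + k + + r + 1ℤ) * (s * det X)
    ≡⟨ cong (s * (x - + k + + r + 1ℤ) *_) negated ⟨
  s * (x - + k + + r + 1ℤ) * charPoly G (- x - 1ℤ) ∎
  where
  c s : ℤ
  c = x + 1ℤ + + r
  s = -1ℤ ^ k
  X : Matrix k
  X i j = scalarMatrix (x + 1ℤ) i j + adjMatrix G i j
  reorder : ∀ x r → x + r + 1ℤ ≡ x + 1ℤ + r
  reorder = solve-∀
  regroup : ∀ s x k r d → (s * s) * ((x + 1ℤ + r - k) * d) ≡ s * (x - k + r + 1ℤ) * (s * d)
  regroup = solve-∀
  complementEntries : ∀ i j → scalarMatrix x i j - adjMatrix (apply o- G) i j ≡ X i j - 1ℤ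
  complementEntries i j with i ≟ j
  ... | yes refl rewrite loopless i = shift x
    where
    shift : ∀ x → x - 0ℤ ≡ x + 1ℤ + 0ℤ - 1ℤ
    shift = solve-∀
  ... | no _ with G i j
  ...   | true  = refl
  ...   | false = refl
  negatedEntries : ∀ i j → scalarMatrix (- x - 1ℤ) i j - adjMatrix G i j ≡ -1ℤ * X i j
  negatedEntries i j with i == j
  ... | true  = negate x (adjMatrix G i j)
    where
    negate : ∀ x g → - x - 1ℤ - g ≡ -1ℤ * (x + 1ℤ + g)
    negate = solve-∀
  ... | false = negate (adjMatrix G i j)
    where
    negate : ∀ g → 0ℤ - g ≡ -1ℤ * (0ℤ + g)
    negate = solve-∀
  negated : charPoly G (- x - 1ℤ) ≡ s * det X
  negated = trans (det-cong negatedEntries) (det-scale -1ℤ X)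
  columnSums : ∀ j → ∑ (λ i → X i j) ≡ c
  columnSums j = begin
    ∑ (λ i → X i j)  ≡⟨ ∑-distrib-+ (λ i → scalarMatrix (x + 1ℤ) i j) (λ i → adjMatrix G i j) ⟩
    ∑ (λ i → scalarMatrix (x + 1ℤ) i j) + ∑ (λ i → adjMatrix G i j)
      ≡⟨ cong₂ _+_ (∑-scalarMatrix-column (x + 1ℤ) j)
                   (trans (∑-indicator (λ i → G i j)) (cong +_ (indeg≡r j))) ⟩
    c ∎

module _ (x y : Op) {n} (adj : Rel n) where
  private
    m : ℕ
    m = numArcs adj

  xy0-↑ˡ-↑ˡ : ∀ i j → xy0 x y adj (i ↑ˡ m) (j ↑ˡ m) ≡ apply x adj i j
  xy0-↑ˡ-↑ˡ i j rewrite splitAt-↑ˡ n i m | splitAt-↑ˡ n j m = refl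

  xy0-↑ˡ-↑ʳ : ∀ i q → xy0 x y adj (i ↑ˡ m) (n ↑ʳ q) ≡ false
  xy0-↑ˡ-↑ʳ i q rewrite splitAt-↑ˡ n i m | splitAt-↑ʳ n m q = refl

  xy0-↑ʳ-↑ʳ : ∀ p q → xy0 x y adj (n ↑ʳ p) (n ↑ʳ q) ≡ apply y (lineDigraph adj) p q
  xy0-↑ʳ-↑ʳ p q rewrite splitAt-↑ʳ n m p | splitAt-↑ʳ n m q = refl

  charPoly-xy0 : ∀ t → charPoly (xy0 x y adj) t ≡ charPoly (apply x adj) t * charPoly (apply y (lineDigraph adj)) t
  charPoly-xy0 t = trans (det-blockLowerTriangular n _ noArcsVE)
    (cong₂ _*_ (det-cong λ i j → entry (==-injective (_↑ˡ m) (↑ˡ-injective m _ _) i j) (xy0-↑ˡ-↑ˡ i j))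
               (det-cong λ p q → entry (==-injective (n ↑ʳ_) (↑ʳ-injective n _ _) p q) (xy0-↑ʳ-↑ʳ p q)))
    where
    entry : ∀ {b b′ c c′} → b ≡ b′ → c ≡ c′ →
            (if b then t else 0ℤ) - (if c then 1ℤ else 0ℤ) ≡ (if b′ then t else 0ℤ) - (if c′ then 1ℤ else 0ℤ)
    entry refl refl = refl
    noArcsVE : ∀ i q → scalarMatrix t (i ↑ˡ m) (n ↑ʳ q) - adjMatrix (xy0 x y adj) (i ↑ˡ m) (n ↑ʳ q) ≡ 0ℤ
    noArcsVE i q rewrite ==-≢ (↑ˡ≢↑ʳ i q) | xy0-↑ˡ-↑ʳ i q = refl

-- Line digraphs

sumList : ∀ {A : Set} → (A → ℤ) → List A → ℤ
sumList h List.[]         = 0ℤ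
sumList h (a List.∷ as) = h a + sumList h as

∑-lookup : ∀ {A : Set} (h : A → ℤ) xs → ∑ (λ e → h (List.lookup xs e)) ≡ sumList h xs
∑-lookup h List.[]         = refl
∑-lookup h (a List.∷ as) = cong (λ t → h a + t) (∑-lookup h as)

sumList-++ : ∀ {A : Set} (h : A → ℤ) xs ys → sumList h (xs List.++ ys) ≡ sumList h xs + sumList h ys
sumList-++ h List.[]         ys = sym (ℤ.+-identityˡ (sumList h ys))
sumList-++ h (a List.∷ as) ys =
  trans (cong (λ t → h a + t) (sumList-++ h as ys)) (sym (ℤ.+-assoc (h a) (sumList h as) (sumList h ys)))

sumList-concatMap : ∀ {A B : Set} (h : B → ℤ) (f : A → List B) xs →
                    sumList h (List.concatMap f xs) ≡ sumList (sumList h ∘ f) xs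
sumList-concatMap h f List.[]         = refl
sumList-concatMap h f (a List.∷ as) =
  trans (sumList-++ h (f a) (List.concatMap f as)) (cong (λ t → sumList h (f a) + t) (sumList-concatMap h f as))

sumList-tabulate : ∀ {A : Set} {k} (h : A → ℤ) (f : Fin k → A) → sumList h (List.tabulate f) ≡ ∑ (h ∘ f)
sumList-tabulate {k = zero}  h f = refl
sumList-tabulate {k = suc k} h f = cong (λ t → h (f zero) + t) (sumList-tabulate h (f ∘ suc))

sumList-allFin : ∀ k (h : Fin k → ℤ) → sumList h (List.allFin k) ≡ ∑ h
sumList-allFin k h = sumList-tabulate h (λ i → i)

module _ {n} (adj : Rel n) where
  private
    m : ℕ
    m = numArcs adj
    A : Matrix n
    A = adjMatrix adj
    arcsFrom : Fin n → Fin n → List (Fin n × Fin n)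
    arcsFrom u v = if adj u v then (u , v) List.∷ List.[] else List.[]

  ∑-arcs : (h : Fin n × Fin n → ℤ) → ∑ (λ e → h (arc adj e)) ≡ ∑ (λ u → ∑ (λ v → A u v * h (u , v)))
  ∑-arcs h = begin
    ∑ (λ e → h (arc adj e))
      ≡⟨ ∑-lookup h (arcs adj) ⟩
    sumList h (arcs adj)
      ≡⟨ sumList-concatMap h (λ u → List.concatMap (arcsFrom u) (List.allFin n)) (List.allFin n) ⟩
    sumList (λ u → sumList h (List.concatMap (arcsFrom u) (List.allFin n))) (List.allFin n)
      ≡⟨ sumList-allFin n (λ u → sumList h (List.concatMap (arcsFrom u) (List.allFin n))) ⟩
    ∑ (λ u → sumList h (List.concatMap (arcsFrom u) (List.allFin n)))
      ≡⟨ ∑-cong (λ u → trans (sumList-concatMap h (arcsFrom u) (List.allFin n))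
                             (trans (sumList-allFin n (sumList h ∘ arcsFrom u)) (∑-cong (single u)))) ⟩
    ∑ (λ u → ∑ (λ v → A u v * h (u , v))) ∎
    where
    single : ∀ u v → sumList h (arcsFrom u v) ≡ A u v * h (u , v)
    single u v with adj u v
    ... | true  = trans (ℤ.+-identityʳ (h (u , v))) (sym (ℤ.*-identityˡ (h (u , v))))
    ... | false = refl

  arc-valid : ∀ e → adj (tail adj e) (head adj e) ≡ true
  arc-valid e = All.lookup valid (∈-lookup e)
    where
    Valid : Fin n × Fin n → Set
    Valid (u , v) = adj u v ≡ true
    from : ∀ u v → All Valid (arcsFrom u v)
    from u v with adj u v in eq
    ... | true  = eq All.∷ All.[]
    ... | false = All.[]
    valid : All Valid (arcs adj)
    valid = concat⁺ (map⁺ (tabulate⁺ λ u → concat⁺ (map⁺ (tabulate⁺ (from u)))))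

  lineDigraph-loopless : Loopless adj → Loopless (lineDigraph adj)
  lineDigraph-loopless loopless e with head adj e ≟ tail adj e
  ... | yes h≡t = trans (sym (arc-valid e)) (trans (cong (adj (tail adj e)) h≡t) (loopless (tail adj e)))
  ... | no _    = refl

  indeg-lineDigraph : ∀ f → indeg (lineDigraph adj) f ≡ indeg adj (tail adj f)
  indeg-lineDigraph f = ℤ.+-injective (begin
    + indeg (lineDigraph adj) f                      ≡⟨ ∑-indicator (λ e → lineDigraph adj e f) ⟨
    ∑ (λ e → identity (head adj e) (tail adj f))     ≡⟨ ∑-arcs (λ uv → identity (proj₂ uv) (tail adj f)) ⟩
    ∑ (λ u → ∑ (λ v → A u v * identity v (tail adj f)))  ≡⟨ ∑-cong (λ u → ∑-scalarMatrixʳ (A u) 1ℤ (tail adj f)) ⟩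
    ∑ (λ u → A u (tail adj f) * 1ℤ)                  ≡⟨ ∑-cong (λ u → ℤ.*-identityʳ (A u (tail adj f))) ⟩
    ∑ (λ u → A u (tail adj f))                       ≡⟨ ∑-indicator (λ u → adj u (tail adj f)) ⟩
    + indeg adj (tail adj f)                         ∎)

  private
    B : Fin m → Fin n → ℤ
    B e u = identity (head adj e) u
    C : Fin n → Fin m → ℤ
    C v e = identity (tail adj e) v

    C*B≡A : ∀ v u → (C *ᴹ B) v u ≡ A v u
    C*B≡A v u = begin
      ∑ (λ e → identity (tail adj e) v * identity (head adj e) u)
        ≡⟨ ∑-arcs (λ uv → identity (proj₁ uv) v * identity (proj₂ uv) u) ⟩
      ∑ (λ a → ∑ (λ b → A a b * (identity a v * identity b u)))
        ≡⟨ ∑-cong (λ a → trans (∑-cong λ b → swap (A a b) (identity a v) (identity b u))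
                               (∑-scalarMatrixʳ (λ b → identity a v * A a b) 1ℤ u)) ⟩
      ∑ (λ a → identity a v * A a u * 1ℤ)
        ≡⟨ ∑-cong (λ a → trans (ℤ.*-identityʳ _) (ℤ.*-comm (identity a v) (A a u))) ⟩
      ∑ (λ a → A a u * identity a v)
        ≡⟨ ∑-scalarMatrixʳ (λ a → A a u) 1ℤ v ⟩
      A v u * 1ℤ
        ≡⟨ ℤ.*-identityʳ (A v u) ⟩
      A v u ∎
      where
      swap : ∀ a x y → a * (x * y) ≡ x * a * y
      swap = solve-∀

    B*C≡A[Dˡ] : ∀ e f → (B *ᴹ C) e f ≡ adjMatrix (lineDigraph adj) e f
    B*C≡A[Dˡ] e f = begin
      ∑ (λ v → identity (head adj e) v * identity (tail adj f) v)
        ≡⟨ ∑-cong (λ v → cong (identity (head adj e) v *_) (scalarMatrix-sym 1ℤ (tail adj f) v)) ⟩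
      ∑ (λ v → identity (head adj e) v * identity v (tail adj f))
        ≡⟨ ∑-scalarMatrixʳ (identity (head adj e)) 1ℤ (tail adj f) ⟩
      identity (head adj e) (tail adj f) * 1ℤ
        ≡⟨ ℤ.*-identityʳ _ ⟩
      identity (head adj e) (tail adj f) ∎

  charPoly-lineDigraph : ∀ x → x ^ m * charPoly adj x ≡ x ^ n * charPoly (lineDigraph adj) x
  charPoly-lineDigraph x = begin
    x ^ m * charPoly adj x
      ≡⟨ cong (x ^ m *_) (det-cong λ v u → cong (λ t → scalarMatrix x v u - t) (C*B≡A v u)) ⟨
    x ^ m * det (λ v u → scalarMatrix x v u - (C *ᴹ B) v u)
      ≡⟨ sylvester B C x ⟩
    x ^ n * det (λ e f → scalarMatrix x e f - (B *ᴹ C) e f)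
      ≡⟨ cong (x ^ n *_) (det-cong λ e f → cong (λ t → scalarMatrix x e f - t) (B*C≡A[Dˡ] e f)) ⟩
    x ^ n * charPoly (lineDigraph adj) x ∎

-- The seven identities

module _ {n} (adj : Rel n) (loopless : Loopless adj) {r} (regular : Regular adj r) (x : ℤ) where
  private
    m : ℕ
    m = numArcs adj
    L : Rel m
    L = lineDigraph adj
    A : ℤ → ℤ
    A = charPoly adj
    N M R s s′ c μ Pn Pm XNR XMR : ℤ
    N = + n
    M = + m
    R = + r
    s = -1ℤ ^ n
    s′ = -1ℤ ^ m
    c = x + R + 1ℤ
    μ = - x - 1ℤ
    Pn = (x + 1ℤ) ^ n
    Pm = (x + 1ℤ) ^ m
    XNR = x - N + R + 1ℤ
    XMR = x - M + R + 1ℤ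
    d⁻ d¹ l⁻ l¹ : ℤ
    d⁻ = charPoly (apply o- adj) x
    d¹ = charPoly (apply o1 adj) x
    l⁻ = charPoly (apply o- L) x
    l¹ = charPoly (apply o1 L) x

  complement-D : c * d⁻ ≡ s * XNR * A μ
  complement-D = charPoly-complement adj loopless r (proj₂ ∘ regular) x

  lineDigraph-at-μ : s′ * Pn * charPoly L μ ≡ s * Pm * A μ
  lineDigraph-at-μ = begin
    s′ * Pn * charPoly L μ              ≡⟨ ℤ.*-identityˡ _ ⟨
    1ℤ * (s′ * Pn * charPoly L μ)       ≡⟨ cong (_* (s′ * Pn * charPoly L μ)) (-1^n*-1^n≡1 n) ⟨
    (s * s) * (s′ * Pn * charPoly L μ)  ≡⟨ regroup₁ s s′ Pn (charPoly L μ) ⟩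
    s′ * s * (s * Pn * charPoly L μ)    ≡⟨ cong (s′ * s *_) sylvester-at-μ ⟨
    s′ * s * (s′ * Pm * A μ)            ≡⟨ regroup₂ s s′ Pm (A μ) ⟩
    (s′ * s′) * (s * Pm * A μ)          ≡⟨ cong (_* (s * Pm * A μ)) (-1^n*-1^n≡1 m) ⟩
    1ℤ * (s * Pm * A μ)                 ≡⟨ ℤ.*-identityˡ _ ⟩
    s * Pm * A μ                        ∎
    where
    sylvester-at-μ : s′ * Pm * A μ ≡ s * Pn * charPoly L μ
    sylvester-at-μ = trans (cong (_* A μ) (sym ([-x-1]^k x m)))
                           (trans (charPoly-lineDigraph adj μ) (cong (_* charPoly L μ) ([-x-1]^k x n)))
    regroup₁ : ∀ s s′ p l → (s * s) * (s′ * p * l) ≡ s′ * s * (s * p * l)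
    regroup₁ = solve-∀
    regroup₂ : ∀ s s′ p a → s′ * s * (s′ * p * a) ≡ (s′ * s′) * (s * p * a)
    regroup₂ = solve-∀

  complement-L : c * Pn * l⁻ ≡ s * Pm * XMR * A μ
  complement-L = begin
    c * Pn * l⁻                     ≡⟨ regroup₁ c Pn l⁻ ⟩
    Pn * (c * l⁻)                   ≡⟨ cong (Pn *_) (charPoly-complement L (lineDigraph-loopless adj loopless) r indeg≡r x) ⟩
    Pn * (s′ * XMR * charPoly L μ)  ≡⟨ regroup₂ Pn s′ XMR (charPoly L μ) ⟩
    XMR * (s′ * Pn * charPoly L μ)  ≡⟨ cong (XMR *_) lineDigraph-at-μ ⟩
    XMR * (s * Pm * A μ)            ≡⟨ regroup₃ XMR s Pm (A μ) ⟩
    s * Pm * XMR * A μ              ∎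
    where
    indeg≡r : ∀ f → indeg L f ≡ r
    indeg≡r f = trans (indeg-lineDigraph adj f) (proj₂ (regular (tail adj f)))
    regroup₁ : ∀ c p l → c * p * l ≡ p * (c * l)
    regroup₁ = solve-∀
    regroup₂ : ∀ p s X l → p * (s * X * l) ≡ X * (s * p * l)
    regroup₂ = solve-∀
    regroup₃ : ∀ X s p a → X * (s * p * a) ≡ s * p * X * a
    regroup₃ = solve-∀

  charPoly-D⁻⁰⁰ : c * charPoly (xy0 o- o0 adj) x ≡ s * x ^ m * XNR * A μ
  charPoly-D⁻⁰⁰ = begin
    c * charPoly (xy0 o- o0 adj) x  ≡⟨ cong (c *_) (trans (charPoly-xy0 o- o0 adj x)
                                                          (cong (d⁻ *_) (charPoly-edgeless L x))) ⟩
    c * (d⁻ * x ^ m)                ≡⟨ ℤ.*-assoc c d⁻ (x ^ m) ⟨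
    c * d⁻ * x ^ m                  ≡⟨ cong (_* x ^ m) complement-D ⟩
    s * XNR * A μ * x ^ m           ≡⟨ regroup s XNR (A μ) (x ^ m) ⟩
    s * x ^ m * XNR * A μ           ∎
    where
    regroup : ∀ s X a p → s * X * a * p ≡ s * p * X * a
    regroup = solve-∀

  charPoly-D⁻¹⁰ : c * (x + 1ℤ) * charPoly (xy0 o- o1 adj) x ≡ s * Pm * (x - M + 1ℤ) * XNR * A μ
  charPoly-D⁻¹⁰ = begin
    c * (x + 1ℤ) * charPoly (xy0 o- o1 adj) x  ≡⟨ cong (c * (x + 1ℤ) *_) (charPoly-xy0 o- o1 adj x) ⟩
    c * (x + 1ℤ) * (d⁻ * l¹)                   ≡⟨ regroup₁ c (x + 1ℤ) d⁻ l¹ ⟩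
    (c * d⁻) * ((x + 1ℤ) * l¹)                 ≡⟨ cong₂ _*_ complement-D (charPoly-complete L x) ⟩
    (s * XNR * A μ) * ((x - M + 1ℤ) * Pm)      ≡⟨ regroup₂ s XNR (A μ) (x - M + 1ℤ) Pm ⟩
    s * Pm * (x - M + 1ℤ) * XNR * A μ          ∎
    where
    regroup₁ : ∀ c p d l → c * p * (d * l) ≡ (c * d) * (p * l)
    regroup₁ = solve-∀
    regroup₂ : ∀ s X a Y P → (s * X * a) * (Y * P) ≡ s * P * Y * X * a
    regroup₂ = solve-∀

  charPoly-D⁰⁻⁰ : c * Pn * charPoly (xy0 o0 o- adj) x ≡ s * x ^ n * Pm * XMR * A μ
  charPoly-D⁰⁻⁰ = begin
    c * Pn * charPoly (xy0 o0 o- adj) x  ≡⟨ cong (c * Pn *_) (trans (charPoly-xy0 o0 o- adj x)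
                                                                   (cong (_* l⁻) (charPoly-edgeless adj x))) ⟩
    c * Pn * (x ^ n * l⁻)                ≡⟨ regroup₁ c Pn (x ^ n) l⁻ ⟩
    x ^ n * (c * Pn * l⁻)                ≡⟨ cong (x ^ n *_) complement-L ⟩
    x ^ n * (s * Pm * XMR * A μ)         ≡⟨ regroup₂ (x ^ n) s Pm XMR (A μ) ⟩
    s * x ^ n * Pm * XMR * A μ           ∎
    where
    regroup₁ : ∀ c p q l → c * p * (q * l) ≡ q * (c * p * l)
    regroup₁ = solve-∀
    regroup₂ : ∀ q s P X a → q * (s * P * X * a) ≡ s * q * P * X * a
    regroup₂ = solve-∀

  charPoly-D¹⁻⁰ : c * (x + 1ℤ) * charPoly (xy0 o1 o- adj) x ≡ s * Pm * (x - N + 1ℤ) * XMR * A μ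
  charPoly-D¹⁻⁰ = begin
    c * (x + 1ℤ) * charPoly (xy0 o1 o- adj) x  ≡⟨ cong (c * (x + 1ℤ) *_) (charPoly-xy0 o1 o- adj x) ⟩
    c * (x + 1ℤ) * (d¹ * l⁻)                   ≡⟨ regroup₁ c (x + 1ℤ) d¹ l⁻ ⟩
    ((x + 1ℤ) * d¹) * (c * l⁻)                 ≡⟨ cong (_* (c * l⁻)) (charPoly-complete adj x) ⟩
    ((x - N + 1ℤ) * Pn) * (c * l⁻)             ≡⟨ regroup₂ (x - N + 1ℤ) Pn c l⁻ ⟩
    (x - N + 1ℤ) * (c * Pn * l⁻)               ≡⟨ cong ((x - N + 1ℤ) *_) complement-L ⟩
    (x - N + 1ℤ) * (s * Pm * XMR * A μ)        ≡⟨ regroup₃ (x - N + 1ℤ) s Pm XMR (A μ) ⟩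
    s * Pm * (x - N + 1ℤ) * XMR * A μ          ∎
    where
    regroup₁ : ∀ c p d l → c * p * (d * l) ≡ (p * d) * (c * l)
    regroup₁ = solve-∀
    regroup₂ : ∀ Y P c l → (Y * P) * (c * l) ≡ Y * (c * P * l)
    regroup₂ = solve-∀
    regroup₃ : ∀ Y s P X a → Y * (s * P * X * a) ≡ s * P * Y * X * a
    regroup₃ = solve-∀

  charPoly-D⁻⁺⁰ : c * x ^ n * charPoly (xy0 o- o+ adj) x ≡ s * x ^ m * XNR * A μ * A x
  charPoly-D⁻⁺⁰ = begin
    c * x ^ n * charPoly (xy0 o- o+ adj) x  ≡⟨ cong (c * x ^ n *_) (charPoly-xy0 o- o+ adj x) ⟩
    c * x ^ n * (d⁻ * charPoly L x)         ≡⟨ regroup₁ c (x ^ n) d⁻ (charPoly L x) ⟩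
    (c * d⁻) * (x ^ n * charPoly L x)       ≡⟨ cong₂ _*_ complement-D (sym (charPoly-lineDigraph adj x)) ⟩
    (s * XNR * A μ) * (x ^ m * A x)         ≡⟨ regroup₂ s XNR (A μ) (x ^ m) (A x) ⟩
    s * x ^ m * XNR * A μ * A x             ∎
    where
    regroup₁ : ∀ c p d l → c * p * (d * l) ≡ (c * d) * (p * l)
    regroup₁ = solve-∀
    regroup₂ : ∀ s X a p b → (s * X * a) * (p * b) ≡ s * p * X * a * b
    regroup₂ = solve-∀

  charPoly-D⁺⁻⁰ : c * Pn * charPoly (xy0 o+ o- adj) x ≡ s * Pm * XMR * A μ * A x
  charPoly-D⁺⁻⁰ = begin
    c * Pn * charPoly (xy0 o+ o- adj) x  ≡⟨ cong (c * Pn *_) (charPoly-xy0 o+ o- adj x) ⟩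
    c * Pn * (A x * l⁻)                  ≡⟨ regroup c Pn (A x) l⁻ ⟩
    A x * (c * Pn * l⁻)                  ≡⟨ cong (A x *_) complement-L ⟩
    A x * (s * Pm * XMR * A μ)           ≡⟨ ℤ.*-comm (A x) (s * Pm * XMR * A μ) ⟩
    s * Pm * XMR * A μ * A x             ∎
    where
    regroup : ∀ c p q l → c * p * (q * l) ≡ q * (c * p * l)
    regroup = solve-∀

  charPoly-D⁻⁻⁰ : c ^ 2 * Pn * charPoly (xy0 o- o- adj) x ≡ Pm * XNR * XMR * A μ ^ 2
  charPoly-D⁻⁻⁰ = begin
    c ^ 2 * Pn * charPoly (xy0 o- o- adj) x  ≡⟨ cong (c ^ 2 * Pn *_) (charPoly-xy0 o- o- adj x) ⟩
    c ^ 2 * Pn * (d⁻ * l⁻)                   ≡⟨ regroup₁ c Pn d⁻ l⁻ ⟩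
    (c * d⁻) * (c * Pn * l⁻)                 ≡⟨ cong₂ _*_ complement-D complement-L ⟩
    (s * XNR * A μ) * (s * Pm * XMR * A μ)   ≡⟨ regroup₂ s XNR (A μ) Pm XMR ⟩
    (s * s) * (Pm * XNR * XMR * A μ ^ 2)     ≡⟨ cong (_* (Pm * XNR * XMR * A μ ^ 2)) (-1^n*-1^n≡1 n) ⟩
    1ℤ * (Pm * XNR * XMR * A μ ^ 2)          ≡⟨ ℤ.*-identityˡ _ ⟩
    Pm * XNR * XMR * A μ ^ 2                 ∎
    where
    regroup₁ : ∀ c p d l → c * (c * 1ℤ) * p * (d * l) ≡ (c * d) * (c * p * l)
    regroup₁ = solve-∀
    regroup₂ : ∀ s X a P Y → (s * X * a) * (s * P * Y * a) ≡ (s * s) * (P * X * Y * (a * (a * 1ℤ)))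
    regroup₂ = solve-∀

theorem4p5 : (n : ℕ) → .{{_ : NonZero n}} → (adj : Rel n) → Loopless adj →
    (r : ℕ) → Regular adj r →
    let m = numArcs adj
        N = + n
        M = + m
        R = + r
        A : ℤ → ℤ
        A = charPoly adj
        s = -1ℤ ^ n
    in (λ' : ℤ) →
      ((λ' + R + 1ℤ) * charPoly (xy0 o- o0 adj) λ'
        ≡ s * (λ' ^ m) * (λ' - N + R + 1ℤ) * A (- λ' - 1ℤ))
      × ((λ' + R + 1ℤ) * (λ' + 1ℤ) * charPoly (xy0 o- o1 adj) λ'
        ≡ s * ((λ' + 1ℤ) ^ m) * (λ' - M + 1ℤ) * (λ' - N + R + 1ℤ) * A (- λ' - 1ℤ))
      × ((λ' + R + 1ℤ) * ((λ' + 1ℤ) ^ n) * charPoly (xy0 o0 o- adj) λ'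
        ≡ s * (λ' ^ n) * ((λ' + 1ℤ) ^ m) * (λ' - M + R + 1ℤ) * A (- λ' - 1ℤ))
      × ((λ' + R + 1ℤ) * (λ' + 1ℤ) * charPoly (xy0 o1 o- adj) λ'
        ≡ s * ((λ' + 1ℤ) ^ m) * (λ' - N + 1ℤ) * (λ' - M + R + 1ℤ) * A (- λ' - 1ℤ))
      × ((λ' + R + 1ℤ) * (λ' ^ n) * charPoly (xy0 o- o+ adj) λ'
        ≡ s * (λ' ^ m) * (λ' - N + R + 1ℤ) * A (- λ' - 1ℤ) * A λ')
      × ((λ' + R + 1ℤ) * ((λ' + 1ℤ) ^ n) * charPoly (xy0 o+ o- adj) λ'
        ≡ s * ((λ' + 1ℤ) ^ m) * (λ' - M + R + 1ℤ) * A (- λ' - 1ℤ) * A λ')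
      × (((λ' + R + 1ℤ) ^ 2) * ((λ' + 1ℤ) ^ n) * charPoly (xy0 o- o- adj) λ'
        ≡ ((λ' + 1ℤ) ^ m) * (λ' - N + R + 1ℤ) * (λ' - M + R + 1ℤ) * (A (- λ' - 1ℤ) ^ 2))
theorem4p5 n adj loopless r regular λ' =
    charPoly-D⁻⁰⁰ adj loopless regular λ'
  , charPoly-D⁻¹⁰ adj loopless regular λ'
  , charPoly-D⁰⁻⁰ adj loopless regular λ'
  , charPoly-D¹⁻⁰ adj loopless regular λ'
  , charPoly-D⁻⁺⁰ adj loopless regular λ'
  , charPoly-D⁺⁻⁰ adj loopless regular λ'
  , charPoly-D⁻⁻⁰ adj loopless regular λ'
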